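{- Let $n\ge1$, $m\ge0$ be integers and let $f_1,f_2\in\mathbb{F}_q[x,y]$ be coprime homogeneous polynomials of degree $n$ of the forms $$f_1(x,y)=a_1x^n+a_2x^{n-1}y+\cdots+a_nxy^{n-1},\qquad f_2(x,y)=b_1x^n+b_2x^{n-1}y+\cdots+b_nxy^{n-1}+b_{n+1}y^n,$$ and let $g(x,y)=c_1x^m+c_2x^{m-1}y+\cdots+c_mxy^{m-1}+c_{m+1}y^m\in\mathbb{F}_q[x,y]$ be a nonzero homogeneous polynomial of degree $m$; when $m\ge1$ assume further that $(0,0)$ is the only zero of $g$ in $\mathbb{F}_q^2$. If $\gcd(m+n,q-1)=1$, then the following are equivalent: (i) the rational function $\frac{f_1(1,t)}{f_2(1,t)}$ is a degree-$n$ rational function that permutes $\mathbb{P}^1(\mathbb{F}_q)=\mathbb{F}_q\cup\{\infty\}$; (ii) the system $(f_1(x,y)g(x,y),\,f_2(x,y)g(x,y))$ is a permutation of $\mathbb{F}_q^2$.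
   Context: A system $(h_1,h_2)$ with $h_i\in\mathbb{F}_q[x,y]$ is a permutation of $\mathbb{F}_q^2$ if for every $(u,v)\in\mathbb{F}_q^2$ the system $h_1(x,y)=u$, $h_2(x,y)=v$ has exactly one solution in $\mathbb{F}_q^2$. For a nonconstant rational function $f=P/Q\in\mathbb{F}_q(t)$ with $P,Q$ coprime, $\deg f=\max\{\deg P,\deg Q\}$; $f$ induces a map $\mathbb{P}^1(\mathbb{F}_q)\to\mathbb{P}^1(\mathbb{F}_q)$ in the usual way (value $\infty$ at zeros of $Q$, and $f(\infty)$ the limiting value), and $f$ permutes $\mathbb{P}^1(\mathbb{F}_q)$ if this map is a bijection. -}

module Defs where

open import Data.Nat using (ℕ; zero; suc; _<ᵇ_; _⊔_)
open import Data.Bool using (Bool; true; false; if_then_else_; _∧_)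
open import Data.List using (List; []; _∷_; map; foldr; replicate; _++_; tabulate; length)
open import Data.List.Membership.Propositional using (_∈_)
open import Data.List.Relation.Unary.Unique.Propositional using (Unique)
open import Data.Fin using (Fin; toℕ; opposite)
import Data.Fin as Fin
open import Data.Maybe using (Maybe; just; nothing)
open import Data.Product using (Σ; _×_; _,_; ∃)
open import Relation.Nullary using (¬_; Dec; yes; no)
open import Relation.Nullary.Decidable using (isYes)
open import Relation.Binary.PropositionalEquality using (_≡_; _≢_)
open import Algebra.Structures using (IsCommutativeRing)

record FiniteField : Set₁ where
  field
    Carrier : Set
    _≟_     : (x y : Carrier) → Dec (x ≡ y)
    0# 1#   : Carrier
    _+_ _*_ : Carrier → Carrier → Carrier
    -_      : Carrier → Carrier
    _⁻¹     : Carrier → Carrier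
    isCommutativeRing : IsCommutativeRing _≡_ _+_ _*_ -_ 0# 1#
    0≢1     : 0# ≢ 1#
    inverseʳ : ∀ x → x ≢ 0# → x * (x ⁻¹) ≡ 1#
    elements : List Carrier
    complete : ∀ x → x ∈ elements
    unique   : Unique elements

  order : ℕ
  order = length elements

ExactlyOne : {A : Set} → (A → Set) → Set
ExactlyOne {A} P = Σ A (λ x → P x × (∀ y → P y → y ≡ x))

-- Generic dense polynomials (coefficient lists, lowest degree first)
-- over a carrier with 0, + and *.

module PolyOps {A : Set} (z : A) (_⊕_ _⊗_ : A → A → A) where

  Poly : Set
  Poly = List A

  _+ₚ_ : Poly → Poly → Poly
  []       +ₚ q        = q
  (a ∷ p)  +ₚ []       = a ∷ p
  (a ∷ p)  +ₚ (b ∷ q)  = (a ⊕ b) ∷ (p +ₚ q)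

  _*ₚ_ : Poly → Poly → Poly
  []      *ₚ q = []
  (a ∷ p) *ₚ q = map (a ⊗_) q +ₚ (z ∷ (p *ₚ q))

  coeff : Poly → ℕ → A
  coeff []      _       = z
  coeff (a ∷ p) zero    = a
  coeff (a ∷ p) (suc k) = coeff p k

  eval : Poly → A → A
  eval []      x = z
  eval (a ∷ p) x = a ⊕ (x ⊗ eval p x)

module _ (F : FiniteField) where
  open FiniteField F

  open PolyOps 0# _+_ _*_ public
    renaming (Poly to Poly1; _+ₚ_ to _+₁_; _*ₚ_ to _*₁_; coeff to coeff1; eval to eval1)

  -- bivariate polynomials F[x,y] = (F[y])[x]: outer index = power of x,
  -- inner index = power of y
  open PolyOps {Poly1} [] _+₁_ _*₁_ public
    renaming (Poly to Poly2; _+ₚ_ to _+₂_; _*ₚ_ to _*₂_; coeff to coeffX; eval to evalX)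

  coeff2 : Poly2 → ℕ → ℕ → Carrier
  coeff2 p i j = coeff1 (coeffX p i) j

  eval2 : Poly2 → Carrier → Carrier → Carrier
  eval2 p x y = eval1 (map (λ r → eval1 r y) p) x

  NonZero1 : Poly1 → Set
  NonZero1 p = ¬ (∀ k → coeff1 p k ≡ 0#)

  Divides1 : Poly1 → Poly1 → Set
  Divides1 d p = ∃ λ h → ∀ k → coeff1 (d *₁ h) k ≡ coeff1 p k

  IsUnit1 : Poly1 → Set
  IsUnit1 d = coeff1 d 0 ≢ 0# × (∀ k → coeff1 d (suc k) ≡ 0#)

  Coprime1 : Poly1 → Poly1 → Set
  Coprime1 p q = ∀ d → Divides1 d p → Divides1 d q → IsUnit1 d

  Divides2 : Poly2 → Poly2 → Set
  Divides2 d p = ∃ λ h → ∀ i j → coeff2 (d *₂ h) i j ≡ coeff2 p i j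

  IsUnit2 : Poly2 → Set
  IsUnit2 d = coeff2 d 0 0 ≢ 0# × (∀ i j → ¬ (i ≡ 0 × j ≡ 0) → coeff2 d i j ≡ 0#)

  Coprime2 : Poly2 → Poly2 → Set
  Coprime2 p q = ∀ d → Divides2 d p → Divides2 d q → IsUnit2 d

  -- the homogeneous form  Σ_{j=0}^{d} c_j x^{d-j} y^j  (c_j = c j)
  yMono : ℕ → Carrier → Poly1
  yMono k a = replicate k 0# ++ (a ∷ [])

  homForm : (d : ℕ) → (Fin (suc d) → Carrier) → Poly2
  homForm d c = tabulate (λ (i : Fin (suc d)) → yMono (toℕ (opposite i)) (c (opposite i)))

  -- extend coefficients a_0..a_{n-1} by a_n = 0 (no y^n term)
  extend0 : {n : ℕ} → (Fin n → Carrier) → Fin (suc n) → Carrier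
  extend0 {zero}  a Fin.zero    = 0#
  extend0 {suc n} a Fin.zero    = a Fin.zero
  extend0 {suc n} a (Fin.suc i) = extend0 (λ j → a (Fin.suc j)) i

  -- dehomogenisation: substitute x = 1, giving a polynomial in t = y
  atX1 : Poly2 → Poly1
  atX1 p = foldr _+₁_ [] p

  -- degree (the zero polynomial gets degree 0) and leading coefficient
  isZero1 : Poly1 → Bool
  isZero1 []      = true
  isZero1 (a ∷ p) = isYes (a ≟ 0#) ∧ isZero1 p

  deg1 : Poly1 → ℕ
  deg1 []      = 0
  deg1 (a ∷ p) = if isZero1 p then 0 else suc (deg1 p)

  lc1 : Poly1 → Carrier
  lc1 p = coeff1 p (deg1 p)

  -- projective line P^1(F) = F ∪ {∞}, with nothing = ∞
  P1 : Set
  P1 = Maybe Carrier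

  -- the map P^1(F) → P^1(F) induced by P/Q, for P, Q coprime
  inducedMap : Poly1 → Poly1 → P1 → P1
  inducedMap P Q (just t) =
    if isYes (eval1 Q t ≟ 0#) then nothing else just (eval1 P t * (eval1 Q t ⁻¹))
  inducedMap P Q nothing =
    if deg1 Q <ᵇ deg1 P then nothing
    else (if deg1 P <ᵇ deg1 Q then just 0# else just (lc1 P * (lc1 Q ⁻¹)))

  PermutesP1 : (P1 → P1) → Set
  PermutesP1 h = ∀ w → ExactlyOne (λ z → h z ≡ w)

  -- the rational function P/Q (Q ≠ 0) has degree d and permutes P^1(F):
  -- written in lowest terms P'/Q' (P',Q' coprime, P Q' = P' Q), one has
  -- max(deg P', deg Q') = d and the induced map on P^1(F) is a bijection.
  IsDegPermRatFun : Poly1 → Poly1 → ℕ → Set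
  IsDegPermRatFun P Q d =
    NonZero1 Q ×
    (∃ λ P' → ∃ λ Q' →
        NonZero1 Q' × Coprime1 P' Q' ×
        (∀ k → coeff1 (P *₁ Q') k ≡ coeff1 (P' *₁ Q) k) ×
        (deg1 P' ⊔ deg1 Q' ≡ d) × PermutesP1 (inducedMap P' Q'))

  PermutesPlane : (Carrier → Carrier → Carrier) → (Carrier → Carrier → Carrier) → Set
  PermutesPlane h1 h2 = ∀ u v →
    ExactlyOne (λ (p : Carrier × Carrier) →
      let (x , y) = p in h1 x y ≡ u × h2 x y ≡ v)

{-# OPTIONS --safe #-}
module Submission where

-- Let P(t) = f₁(1, t), Q(t) = f₂(1, t), N = m + n and G = (f₁ g, f₂ g). Since f(x, y) = x ^ n f(1, y / x),
-- G maps the line of slope t through the origin into the line through (P(t), Q(t)): G lies over the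
-- map φ = P / Q of P¹, the set of such lines. G is homogeneous of degree N and vanishes only at the
-- origin (f₁, f₂ have no common zero off it by coprimality, g by hypothesis), so along one line it is
-- λ ↦ λ ^ N times a fixed nonzero vector; as gcd(N, q − 1) = 1, λ ↦ λ ^ N permutes F_q^* (Fermat and
-- Bézout). Hence G permutes F_q² iff φ permutes P¹. Coprimality also forces the coefficient of y ^ n in
-- f₂ to be nonzero (else x divides both forms) and makes P / Q reduced, so deg φ = deg Q = n > deg P.

open import Defs
open import Data.Nat as ℕ using (ℕ; zero; suc; z≤n; s≤s)
import Data.Nat.Properties as ℕ
open import Data.Nat.GCD using (gcd; gcd-GCD; module Bézout)
open import Data.List using (List; []; _∷_; map; foldr; filter; length; tabulate)
open import Data.Fin as Fin using (Fin; toℕ; fromℕ<; opposite)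
import Data.Fin.Properties as Fin
open import Data.List.Membership.Propositional using (_∈_)
import Data.List.Membership.Propositional.Properties as Mem
open import Data.List.Membership.Propositional.Properties.WithK using (unique∧set⇒bag)
open import Data.List.Relation.Unary.Any using (here; there)
open import Data.List.Relation.Unary.All using (All; []; _∷_)
import Data.List.Relation.Unary.All as All
open import Data.List.Relation.Unary.All.Properties using (all-filter)
open import Data.List.Relation.Unary.Unique.Propositional using (Unique)
open import Data.List.Relation.Unary.AllPairs using (_∷_)
import Data.List.Relation.Unary.Unique.Propositional.Properties as Unique
open import Data.List.Relation.Binary.Permutation.Propositional using (_↭_; ↭⇒↭ₛ)
open import Data.List.Relation.Binary.Permutation.Propositional.Properties using (↭-length)
open import Data.List.Relation.Binary.BagAndSetEquality using (∼bag⇒↭)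
import Data.List.Relation.Binary.Permutation.Setoid.Properties as Perm
open import Data.Product using (∃; ∃₂; _×_; _,_; proj₁; proj₂; swap; uncurry)
open import Data.Product.Properties using (×-≡,≡→≡; ×-≡,≡←≡; ,-injectiveˡ; ,-injectiveʳ)
open import Data.Maybe using (just; nothing)
open import Data.Maybe.Properties using (just-injective)
open import Data.Bool using (true; false; if_then_else_; T)
open import Data.Unit using (tt)
open import Data.Empty using (⊥-elim)
open import Data.Sum using (_⊎_; inj₁; inj₂)
open import Relation.Nullary using (¬_; yes; no)
open import Relation.Nullary.Decidable using (¬?; isYes; _×-dec_)
open import Relation.Binary.PropositionalEquality
open import Function.Base using (_∘_)
open import Function.Bundles using (_⇔_; mk⇔; Equivalence)
open import Function.Properties.Equivalence using () renaming (trans to ⇔-trans)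
open import Function.Definitions using (Injective; StrictlySurjective)
open import Algebra.Structures using (IsCommutativeRing)
open import Algebra.Bundles using (CommutativeRing)
import Algebra.Properties.Semiring.Exp as SemiringExp
import Algebra.Properties.CommutativeSemiring.Exp as CommutativeSemiringExp

module _ {A B : Set} {f : A → B} where

  exactlyOne⇒injective : (∀ y → ExactlyOne (λ x → f x ≡ y)) → Injective _≡_ _≡_ f
  exactlyOne⇒injective one {x} {x′} fx≡fx′ = trans (unique x fx≡fx′) (sym (unique x′ refl))
    where unique = proj₂ (proj₂ (one (f x′)))

  exactlyOne⇒surjective : (∀ y → ExactlyOne (λ x → f x ≡ y)) → StrictlySurjective _≡_ f
  exactlyOne⇒surjective one y = proj₁ (one y) , proj₁ (proj₂ (one y))

  bijective⇒exactlyOne : Injective _≡_ _≡_ f → StrictlySurjective _≡_ f → ∀ y → ExactlyOne (λ x → f x ≡ y)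
  bijective⇒exactlyOne inj surj y with surj y
  ... | x , fx≡y = x , fx≡y , λ x′ fx′≡y → inj (trans fx′≡y (sym fx≡y))

unique-sameElements⇒↭ : ∀ {A : Set} {xs ys : List A} → Unique xs → Unique ys → (∀ {x} → x ∈ xs ⇔ x ∈ ys) → xs ↭ ys
unique-sameElements⇒↭ uxs uys same = ∼bag⇒↭ (unique∧set⇒bag uxs uys same)

module _ (F : FiniteField) where
  open FiniteField F renaming (_+_ to infixl 6 _+_; _*_ to infixl 7 _*_; -_ to infix 8 -_)
  open IsCommutativeRing isCommutativeRing
    using ( +-identityˡ; +-identityʳ; *-assoc; *-comm; *-identityˡ; *-identityʳ
          ; zeroˡ; zeroʳ; -‿inverseˡ; *-isCommutativeMonoid)

  commutativeRing : CommutativeRing _ _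
  commutativeRing = record { isCommutativeRing = isCommutativeRing }

  open CommutativeRing commutativeRing using (semiring; commutativeSemiring)
  open SemiringExp semiring using (_^_; ^-homo-*; ^-assocʳ)
  open CommutativeSemiringExp commutativeSemiring using (^-distrib-*)
  open import Algebra.Solver.Ring.NaturalCoefficients.Default commutativeSemiring

  inverseˡ : ∀ x → x ≢ 0# → x ⁻¹ * x ≡ 1#
  inverseˡ x x≢0 = trans (*-comm _ _) (inverseʳ x x≢0)

  1≢0 : 1# ≢ 0#
  1≢0 1≡0 = 0≢1 (sym 1≡0)

  *-cancelˡ : ∀ {x a b} → x ≢ 0# → x * a ≡ x * b → a ≡ b
  *-cancelˡ {x} {a} {b} x≢0 xa≡xb = begin
    a              ≡⟨ sym (*-identityˡ a) ⟩
    1# * a         ≡⟨ cong (_* a) (sym (inverseˡ x x≢0)) ⟩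
    x ⁻¹ * x * a   ≡⟨ *-assoc _ _ _ ⟩
    x ⁻¹ * (x * a) ≡⟨ cong (x ⁻¹ *_) xa≡xb ⟩
    x ⁻¹ * (x * b) ≡⟨ sym (*-assoc _ _ _) ⟩
    x ⁻¹ * x * b   ≡⟨ cong (_* b) (inverseˡ x x≢0) ⟩
    1# * b         ≡⟨ *-identityˡ b ⟩
    b              ∎
    where open ≡-Reasoning

  x*y≡0⇒y≡0 : ∀ {x y} → x ≢ 0# → x * y ≡ 0# → y ≡ 0#
  x*y≡0⇒y≡0 {x} x≢0 xy≡0 = *-cancelˡ x≢0 (trans xy≡0 (sym (zeroʳ x)))

  *-≢0 : ∀ {x y} → x ≢ 0# → y ≢ 0# → x * y ≢ 0#
  *-≢0 x≢0 y≢0 xy≡0 = y≢0 (x*y≡0⇒y≡0 x≢0 xy≡0)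

  ⁻¹-≢0 : ∀ {x} → x ≢ 0# → x ⁻¹ ≢ 0#
  ⁻¹-≢0 {x} x≢0 x⁻¹≡0 = 1≢0 (trans (sym (inverseʳ x x≢0)) (trans (cong (x *_) x⁻¹≡0) (zeroʳ x)))

  1⁻¹≡1 : 1# ⁻¹ ≡ 1#
  1⁻¹≡1 = trans (sym (*-identityˡ _)) (inverseʳ 1# 1≢0)

  *-/-cancel : ∀ x {y} → y ≢ 0# → x * y * y ⁻¹ ≡ x
  *-/-cancel x {y} y≢0 = trans (*-assoc _ _ _) (trans (cong (x *_) (inverseʳ y y≢0)) (*-identityʳ x))

  /-*-cancel : ∀ x {y} → y ≢ 0# → x * y ⁻¹ * y ≡ x
  /-*-cancel x {y} y≢0 = trans (*-assoc _ _ _) (trans (cong (x *_) (inverseˡ y y≢0)) (*-identityʳ x))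

  /-unique : ∀ {x y z} → y ≢ 0# → x ≡ z * y → x * y ⁻¹ ≡ z
  /-unique {y = y} {z} y≢0 refl = *-/-cancel z y≢0

  1^n≡1 : ∀ n → 1# ^ n ≡ 1#
  1^n≡1 zero    = refl
  1^n≡1 (suc n) = trans (*-identityˡ _) (1^n≡1 n)

  ^-≢0 : ∀ {x} n → x ≢ 0# → x ^ n ≢ 0#
  ^-≢0 zero    x≢0 = 1≢0
  ^-≢0 (suc n) x≢0 = *-≢0 x≢0 (^-≢0 n x≢0)

  -- Fermat's little theorem: multiplication by μ ≠ 0 permutes the nonzero elements.

  ∏ : List Carrier → Carrier
  ∏ = foldr _*_ 1#

  ∏-↭ : ∀ {xs ys} → xs ↭ ys → ∏ xs ≡ ∏ ys
  ∏-↭ p = Perm.foldr-commMonoid (setoid Carrier) *-isCommutativeMonoid (↭⇒↭ₛ p)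

  ∏-map-* : ∀ μ xs → ∏ (map (μ *_) xs) ≡ μ ^ length xs * ∏ xs
  ∏-map-* μ []       = sym (*-identityˡ 1#)
  ∏-map-* μ (x ∷ xs) = trans (cong (μ * x *_) (∏-map-* μ xs))
    (solve 4 (λ μ x a b → μ :* x :* (a :* b) := μ :* a :* (x :* b)) refl μ x (μ ^ length xs) (∏ xs))

  ∏-≢0 : ∀ {xs} → All (_≢ 0#) xs → ∏ xs ≢ 0#
  ∏-≢0 []         = 1≢0
  ∏-≢0 (x≢0 ∷ xs) = *-≢0 x≢0 (∏-≢0 xs)

  nonzeroElements : List Carrier
  nonzeroElements = filter (λ x → ¬? (x ≟ 0#)) elements

  nonzeroElements-≢0 : All (_≢ 0#) nonzeroElements
  nonzeroElements-≢0 = all-filter (λ x → ¬? (x ≟ 0#)) elements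

  ∈-nonzeroElements : ∀ {x} → x ≢ 0# → x ∈ nonzeroElements
  ∈-nonzeroElements x≢0 = Mem.∈-filter⁺ (λ x → ¬? (x ≟ 0#)) (complete _) x≢0

  nonzeroElements-unique : Unique nonzeroElements
  nonzeroElements-unique = Unique.filter⁺ (λ x → ¬? (x ≟ 0#)) unique

  elements↭0∷nonzeroElements : elements ↭ 0# ∷ nonzeroElements
  elements↭0∷nonzeroElements = unique-sameElements⇒↭ unique
    (All.map (λ x≢0 0≡x → x≢0 (sym 0≡x)) nonzeroElements-≢0 ∷ nonzeroElements-unique)
    (mk⇔ to (λ _ → complete _))
    where
    to : ∀ {x} → x ∈ elements → x ∈ 0# ∷ nonzeroElements
    to {x} _ with x ≟ 0#
    ... | yes x≡0 = here x≡0
    ... | no  x≢0 = there (∈-nonzeroElements x≢0)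

  *-nonzeroElements-↭ : ∀ {μ} → μ ≢ 0# → map (μ *_) nonzeroElements ↭ nonzeroElements
  *-nonzeroElements-↭ {μ} μ≢0 = unique-sameElements⇒↭
    (Unique.map⁺ (*-cancelˡ μ≢0) nonzeroElements-unique) nonzeroElements-unique
    (mk⇔ to from)
    where
    to : ∀ {x} → x ∈ map (μ *_) nonzeroElements → x ∈ nonzeroElements
    to x∈ with Mem.∈-map⁻ (μ *_) x∈
    ... | y , y∈ , refl = ∈-nonzeroElements (*-≢0 μ≢0 (All.lookup nonzeroElements-≢0 y∈))
    from : ∀ {x} → x ∈ nonzeroElements → x ∈ map (μ *_) nonzeroElements
    from {x} x∈ = subst (_∈ map (μ *_) nonzeroElements) μ[μ⁻¹x]≡x
      (Mem.∈-map⁺ (μ *_) (∈-nonzeroElements (*-≢0 (⁻¹-≢0 μ≢0) (All.lookup nonzeroElements-≢0 x∈))))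
      where
      μ[μ⁻¹x]≡x : μ * (μ ⁻¹ * x) ≡ x
      μ[μ⁻¹x]≡x = trans (sym (*-assoc _ _ _)) (trans (cong (_* x) (inverseʳ μ μ≢0)) (*-identityˡ x))

  order∸1≡|nonzeroElements| : order ℕ.∸ 1 ≡ length nonzeroElements
  order∸1≡|nonzeroElements| = cong (ℕ._∸ 1) (↭-length elements↭0∷nonzeroElements)

  fermat : ∀ {μ} → μ ≢ 0# → μ ^ (order ℕ.∸ 1) ≡ 1#
  fermat {μ} μ≢0 = *-cancelˡ (∏-≢0 nonzeroElements-≢0) (begin
    ∏ nonzeroElements * μ ^ (order ℕ.∸ 1)                 ≡⟨ *-comm _ _ ⟩
    μ ^ (order ℕ.∸ 1) * ∏ nonzeroElements                 ≡⟨ cong (λ k → μ ^ k * ∏ nonzeroElements) order∸1≡|nonzeroElements| ⟩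
    μ ^ length nonzeroElements * ∏ nonzeroElements        ≡⟨ sym (∏-map-* μ nonzeroElements) ⟩
    ∏ (map (μ *_) nonzeroElements)                        ≡⟨ ∏-↭ (*-nonzeroElements-↭ μ≢0) ⟩
    ∏ nonzeroElements                                     ≡⟨ sym (*-identityʳ _) ⟩
    ∏ nonzeroElements * 1#                                ∎)
    where open ≡-Reasoning

  ^-*ˡ : ∀ x m n → x ^ (m ℕ.* n) ≡ (x ^ n) ^ m
  ^-*ˡ x m n = trans (cong (x ^_) (ℕ.*-comm m n)) (sym (^-assocʳ x n m))

  module NthPowers (N : ℕ) (gcd[N,q-1]≡1 : gcd N (order ℕ.∸ 1) ≡ 1) where

    private
      q-1 : ℕ
      q-1 = order ℕ.∸ 1

    bézout : Bézout.Identity 1 N q-1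
    bézout = subst (λ d → Bézout.Identity d N q-1) gcd[N,q-1]≡1 (Bézout.identity (gcd-GCD N q-1))

    ^-multiple-of-q-1 : ∀ {μ} → μ ≢ 0# → ∀ k → μ ^ (k ℕ.* q-1) ≡ 1#
    ^-multiple-of-q-1 {μ} μ≢0 k = trans (^-*ˡ μ k q-1) (trans (cong (_^ k) (fermat μ≢0)) (1^n≡1 k))

    nthRoot : ∀ {μ} → μ ≢ 0# → ∃ λ l → l ≢ 0# × l ^ N ≡ μ
    nthRoot {μ} μ≢0 with bézout
    ... | Bézout.+- x y 1+y[q-1]≡xN = μ ^ x , ^-≢0 x μ≢0 , (begin
      (μ ^ x) ^ N          ≡⟨ sym (^-*ˡ μ N x) ⟩
      μ ^ (N ℕ.* x)        ≡⟨ cong (μ ^_) (trans (ℕ.*-comm N x) (sym 1+y[q-1]≡xN)) ⟩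
      μ * μ ^ (y ℕ.* q-1)  ≡⟨ cong (μ *_) (^-multiple-of-q-1 μ≢0 y) ⟩
      μ * 1#               ≡⟨ *-identityʳ μ ⟩
      μ                    ∎)
      where open ≡-Reasoning
    ... | Bézout.-+ x y 1+xN≡y[q-1] = ν ⁻¹ , ⁻¹-≢0 ν≢0 , (begin
      (ν ⁻¹) ^ N                 ≡⟨ sym (*-identityʳ _) ⟩
      (ν ⁻¹) ^ N * 1#            ≡⟨ cong ((ν ⁻¹) ^ N *_) (sym μν^N≡1) ⟩
      (ν ⁻¹) ^ N * (μ * ν ^ N)   ≡⟨ solve 3 (λ a m b → a :* (m :* b) := m :* (a :* b)) refl ((ν ⁻¹) ^ N) μ (ν ^ N) ⟩
      μ * ((ν ⁻¹) ^ N * ν ^ N)   ≡⟨ cong (μ *_) (sym (^-distrib-* (ν ⁻¹) ν N)) ⟩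
      μ * (ν ⁻¹ * ν) ^ N         ≡⟨ cong (λ z → μ * z ^ N) (inverseˡ ν ν≢0) ⟩
      μ * 1# ^ N                 ≡⟨ cong (μ *_) (1^n≡1 N) ⟩
      μ * 1#                     ≡⟨ *-identityʳ μ ⟩
      μ                          ∎)
      where
      open ≡-Reasoning
      ν : Carrier
      ν = μ ^ x
      ν≢0 : ν ≢ 0#
      ν≢0 = ^-≢0 x μ≢0
      μν^N≡1 : μ * ν ^ N ≡ 1#
      μν^N≡1 = begin
        μ * (μ ^ x) ^ N        ≡⟨ cong (μ *_) (sym (^-*ˡ μ N x)) ⟩
        μ * μ ^ (N ℕ.* x)      ≡⟨ cong (μ ^_) (trans (cong suc (ℕ.*-comm N x)) 1+xN≡y[q-1]) ⟩
        μ ^ (y ℕ.* q-1)        ≡⟨ ^-multiple-of-q-1 μ≢0 y ⟩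
        1#                     ∎

    ^N≡1⇒≡1 : ∀ {l} → l ≢ 0# → l ^ N ≡ 1# → l ≡ 1#
    ^N≡1⇒≡1 {l} l≢0 l^N≡1 with bézout
    ... | Bézout.+- x y 1+y[q-1]≡xN = begin
      l                       ≡⟨ sym (*-identityʳ l) ⟩
      l * 1#                  ≡⟨ cong (l *_) (sym (^-multiple-of-q-1 l≢0 y)) ⟩
      l * l ^ (y ℕ.* q-1)     ≡⟨ cong (l ^_) 1+y[q-1]≡xN ⟩
      l ^ (x ℕ.* N)           ≡⟨ ^-*ˡ l x N ⟩
      (l ^ N) ^ x             ≡⟨ cong (_^ x) l^N≡1 ⟩
      1# ^ x                  ≡⟨ 1^n≡1 x ⟩
      1#                      ∎
      where open ≡-Reasoning
    ... | Bézout.-+ x y 1+xN≡y[q-1] = sym (begin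
      1#                      ≡⟨ sym (^-multiple-of-q-1 l≢0 y) ⟩
      l ^ (y ℕ.* q-1)         ≡⟨ cong (l ^_) (sym 1+xN≡y[q-1]) ⟩
      l * l ^ (x ℕ.* N)       ≡⟨ cong (l *_) (^-*ˡ l x N) ⟩
      l * (l ^ N) ^ x         ≡⟨ cong (λ z → l * z ^ x) l^N≡1 ⟩
      l * 1# ^ x              ≡⟨ cong (l *_) (1^n≡1 x) ⟩
      l * 1#                  ≡⟨ *-identityʳ l ⟩
      l                       ∎)
      where open ≡-Reasoning

  -- Univariate polynomials, compared coefficientwise since lists may carry trailing zeros

  infixl 6 _⊞_
  infixl 7 _⊠_
  _⊞_ : Poly1 F → Poly1 F → Poly1 F
  _⊞_ = _+₁_ F
  _⊠_ : Poly1 F → Poly1 F → Poly1 F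
  _⊠_ = _*₁_ F
  coeff : Poly1 F → ℕ → Carrier
  coeff = coeff1 F
  eval : Poly1 F → Carrier → Carrier
  eval = eval1 F

  infix 4 _≋_
  _≋_ : Poly1 F → Poly1 F → Set
  p ≋ q = ∀ k → coeff p k ≡ coeff q k

  ≋-trans : ∀ {p q r} → p ≋ q → q ≋ r → p ≋ r
  ≋-trans p≋q q≋r k = trans (p≋q k) (q≋r k)

  IsZero : Poly1 F → Set
  IsZero p = ∀ k → coeff p k ≡ 0#

  coeff-⊞ : ∀ p q k → coeff (p ⊞ q) k ≡ coeff p k + coeff q k
  coeff-⊞ []      q       k       = sym (+-identityˡ _)
  coeff-⊞ (a ∷ p) []      k       = sym (+-identityʳ _)
  coeff-⊞ (a ∷ p) (b ∷ q) zero    = refl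
  coeff-⊞ (a ∷ p) (b ∷ q) (suc k) = coeff-⊞ p q k

  coeff-map-* : ∀ a q k → coeff (map (a *_) q) k ≡ a * coeff q k
  coeff-map-* a []      k       = sym (zeroʳ a)
  coeff-map-* a (b ∷ q) zero    = refl
  coeff-map-* a (b ∷ q) (suc k) = coeff-map-* a q k

  coeff-∷-⊠ : ∀ a p q k → coeff ((a ∷ p) ⊠ q) k ≡ a * coeff q k + coeff (0# ∷ (p ⊠ q)) k
  coeff-∷-⊠ a p q k = trans (coeff-⊞ (map (a *_) q) (0# ∷ (p ⊠ q)) k) (cong (_+ _) (coeff-map-* a q k))

  0∷-IsZero : ∀ {p} → IsZero p → IsZero (0# ∷ p)
  0∷-IsZero p≡0 zero    = refl
  0∷-IsZero p≡0 (suc k) = p≡0 k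

  0∷-≋ : ∀ {p q} → p ≋ q → 0# ∷ p ≋ 0# ∷ q
  0∷-≋ p≋q zero    = refl
  0∷-≋ p≋q (suc k) = p≋q k

  coeff-0∷-⊞ : ∀ {p q r} → p ≋ q ⊞ r → ∀ k → coeff (0# ∷ p) k ≡ coeff (0# ∷ q) k + coeff (0# ∷ r) k
  coeff-0∷-⊞ p≋q+r zero    = sym (+-identityˡ 0#)
  coeff-0∷-⊞ {q = q} {r} p≋q+r (suc k) = trans (p≋q+r k) (coeff-⊞ q r k)

  IsZero-⊠ˡ : ∀ p q → IsZero p → IsZero (p ⊠ q)
  IsZero-⊠ˡ []      q p≡0 k = refl
  IsZero-⊠ˡ (a ∷ p) q p≡0 k = begin
    coeff ((a ∷ p) ⊠ q) k                       ≡⟨ coeff-∷-⊠ a p q k ⟩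
    a * coeff q k + coeff (0# ∷ (p ⊠ q)) k      ≡⟨ cong₂ _+_ (cong (_* coeff q k) (p≡0 0)) (0∷-IsZero (IsZero-⊠ˡ p q (p≡0 ∘ suc)) k) ⟩
    0# * coeff q k + 0#                         ≡⟨ trans (+-identityʳ _) (zeroˡ _) ⟩
    0#                                          ∎
    where open ≡-Reasoning

  IsZero-⊠ʳ : ∀ p q → IsZero q → IsZero (p ⊠ q)
  IsZero-⊠ʳ []      q q≡0 k = refl
  IsZero-⊠ʳ (a ∷ p) q q≡0 k = begin
    coeff ((a ∷ p) ⊠ q) k                       ≡⟨ coeff-∷-⊠ a p q k ⟩
    a * coeff q k + coeff (0# ∷ (p ⊠ q)) k      ≡⟨ cong₂ _+_ (cong (a *_) (q≡0 k)) (0∷-IsZero (IsZero-⊠ʳ p q q≡0) k) ⟩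
    a * 0# + 0#                                 ≡⟨ trans (+-identityʳ _) (zeroʳ a) ⟩
    0#                                          ∎
    where open ≡-Reasoning

  ⊠-congʳ : ∀ p p′ q → p ≋ p′ → p ⊠ q ≋ p′ ⊠ q
  ⊠-congʳ []      []       q p≋p′ k = refl
  ⊠-congʳ []      (b ∷ p′) q p≋p′ k = sym (IsZero-⊠ˡ (b ∷ p′) q (sym ∘ p≋p′) k)
  ⊠-congʳ (a ∷ p) []       q p≋p′ k = IsZero-⊠ˡ (a ∷ p) q p≋p′ k
  ⊠-congʳ (a ∷ p) (b ∷ p′) q p≋p′ k = begin
    coeff ((a ∷ p) ⊠ q) k                       ≡⟨ coeff-∷-⊠ a p q k ⟩
    a * coeff q k + coeff (0# ∷ (p ⊠ q)) k      ≡⟨ cong₂ _+_ (cong (_* coeff q k) (p≋p′ 0)) (0∷-≋ (⊠-congʳ p p′ q (p≋p′ ∘ suc)) k) ⟩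
    b * coeff q k + coeff (0# ∷ (p′ ⊠ q)) k     ≡⟨ coeff-∷-⊠ b p′ q k ⟨
    coeff ((b ∷ p′) ⊠ q) k                      ∎
    where open ≡-Reasoning

  ⊠-congˡ : ∀ p q q′ → q ≋ q′ → p ⊠ q ≋ p ⊠ q′
  ⊠-congˡ []      q q′ q≋q′ k = refl
  ⊠-congˡ (a ∷ p) q q′ q≋q′ k = begin
    coeff ((a ∷ p) ⊠ q) k                       ≡⟨ coeff-∷-⊠ a p q k ⟩
    a * coeff q k + coeff (0# ∷ (p ⊠ q)) k      ≡⟨ cong₂ _+_ (cong (a *_) (q≋q′ k)) (0∷-≋ (⊠-congˡ p q q′ q≋q′) k) ⟩
    a * coeff q′ k + coeff (0# ∷ (p ⊠ q′)) k    ≡⟨ coeff-∷-⊠ a p q′ k ⟨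
    coeff ((a ∷ p) ⊠ q′) k                      ∎
    where open ≡-Reasoning

  ⊠-cong : ∀ {p p′ q q′} → p ≋ p′ → q ≋ q′ → p ⊠ q ≋ p′ ⊠ q′
  ⊠-cong {p} {p′} {q} {q′} p≋p′ q≋q′ = ≋-trans {p ⊠ q} {p′ ⊠ q} {p′ ⊠ q′} (⊠-congʳ p p′ q p≋p′) (⊠-congˡ p′ q q′ q≋q′)

  ⊠-distribˡ-⊞ : ∀ p q r → p ⊠ (q ⊞ r) ≋ p ⊠ q ⊞ p ⊠ r
  ⊠-distribˡ-⊞ []      q r k = refl
  ⊠-distribˡ-⊞ (a ∷ p) q r k = begin
    coeff ((a ∷ p) ⊠ (q ⊞ r)) k
      ≡⟨ coeff-∷-⊠ a p (q ⊞ r) k ⟩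
    a * coeff (q ⊞ r) k + coeff (0# ∷ (p ⊠ (q ⊞ r))) k
      ≡⟨ cong₂ _+_ (cong (a *_) (coeff-⊞ q r k)) (coeff-0∷-⊞ (⊠-distribˡ-⊞ p q r) k) ⟩
    a * (coeff q k + coeff r k) + (coeff (0# ∷ (p ⊠ q)) k + coeff (0# ∷ (p ⊠ r)) k)
      ≡⟨ solve 5 (λ a q r x y → a :* (q :+ r) :+ (x :+ y) := (a :* q :+ x) :+ (a :* r :+ y)) refl
                 a (coeff q k) (coeff r k) (coeff (0# ∷ (p ⊠ q)) k) (coeff (0# ∷ (p ⊠ r)) k) ⟩
    (a * coeff q k + coeff (0# ∷ (p ⊠ q)) k) + (a * coeff r k + coeff (0# ∷ (p ⊠ r)) k)
      ≡⟨ cong₂ _+_ (coeff-∷-⊠ a p q k) (coeff-∷-⊠ a p r k) ⟨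
    coeff ((a ∷ p) ⊠ q) k + coeff ((a ∷ p) ⊠ r) k
      ≡⟨ coeff-⊞ ((a ∷ p) ⊠ q) ((a ∷ p) ⊠ r) k ⟨
    coeff ((a ∷ p) ⊠ q ⊞ (a ∷ p) ⊠ r) k
      ∎
    where open ≡-Reasoning

  ⊠-distribʳ-⊞ : ∀ p q r → (q ⊞ r) ⊠ p ≋ q ⊠ p ⊞ r ⊠ p
  ⊠-distribʳ-⊞ p []      r       k = refl
  ⊠-distribʳ-⊞ p (a ∷ q) []      k = sym (trans (coeff-⊞ ((a ∷ q) ⊠ p) [] k) (+-identityʳ _))
  ⊠-distribʳ-⊞ p (a ∷ q) (b ∷ r) k = begin
    coeff ((a + b ∷ q ⊞ r) ⊠ p) k
      ≡⟨ coeff-∷-⊠ (a + b) (q ⊞ r) p k ⟩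
    (a + b) * coeff p k + coeff (0# ∷ ((q ⊞ r) ⊠ p)) k
      ≡⟨ cong ((a + b) * coeff p k +_) (coeff-0∷-⊞ (⊠-distribʳ-⊞ p q r) k) ⟩
    (a + b) * coeff p k + (coeff (0# ∷ (q ⊠ p)) k + coeff (0# ∷ (r ⊠ p)) k)
      ≡⟨ solve 5 (λ a b p x y → (a :+ b) :* p :+ (x :+ y) := (a :* p :+ x) :+ (b :* p :+ y)) refl
                 a b (coeff p k) (coeff (0# ∷ (q ⊠ p)) k) (coeff (0# ∷ (r ⊠ p)) k) ⟩
    (a * coeff p k + coeff (0# ∷ (q ⊠ p)) k) + (b * coeff p k + coeff (0# ∷ (r ⊠ p)) k)
      ≡⟨ cong₂ _+_ (coeff-∷-⊠ a q p k) (coeff-∷-⊠ b r p k) ⟨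
    coeff ((a ∷ q) ⊠ p) k + coeff ((b ∷ r) ⊠ p) k
      ≡⟨ coeff-⊞ ((a ∷ q) ⊠ p) ((b ∷ r) ⊠ p) k ⟨
    coeff ((a ∷ q) ⊠ p ⊞ (b ∷ r) ⊠ p) k
      ∎
    where open ≡-Reasoning

  ⊠-identityˡ : ∀ p → (1# ∷ []) ⊠ p ≋ p
  ⊠-identityˡ p k = trans (coeff-∷-⊠ 1# [] p k) (trans (cong₂ _+_ (*-identityˡ _) (0∷-IsZero (λ _ → refl) k)) (+-identityʳ _))

  DegreeAtMost : ℕ → Poly1 F → Set
  DegreeAtMost d p = ∀ k → d ℕ.< k → coeff p k ≡ 0#

  HasDegree : ℕ → Poly1 F → Set
  HasDegree d p = coeff p d ≢ 0# × DegreeAtMost d p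

  IsZero⊎HasDegree : ∀ p → IsZero p ⊎ ∃ λ d → HasDegree d p
  IsZero⊎HasDegree [] = inj₁ (λ _ → refl)
  IsZero⊎HasDegree (a ∷ p) with IsZero⊎HasDegree p
  ... | inj₂ (d , p[d]≢0 , p≤d) = inj₂ (suc d , p[d]≢0 , λ { (suc k) (s≤s d<k) → p≤d k d<k })
  ... | inj₁ p≡0 with a ≟ 0#
  ...   | yes a≡0 = inj₁ (λ { zero → a≡0 ; (suc k) → p≡0 k })
  ...   | no  a≢0 = inj₂ (0 , a≢0 , λ { (suc k) _ → p≡0 k })

  HasDegree⇒≤ : ∀ p {d e} → HasDegree d p → DegreeAtMost e p → d ℕ.≤ e
  HasDegree⇒≤ p {d} {e} (p[d]≢0 , _) p≤e with ℕ.≤-<-connex d e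
  ... | inj₁ d≤e = d≤e
  ... | inj₂ e<d = ⊥-elim (p[d]≢0 (p≤e d e<d))

  HasDegree-unique : ∀ p {d e} → HasDegree d p → HasDegree e p → d ≡ e
  HasDegree-unique p deg-d deg-e = ℕ.≤-antisym (HasDegree⇒≤ p deg-d (proj₂ deg-e)) (HasDegree⇒≤ p deg-e (proj₂ deg-d))

  DegreeAtMost-mono : ∀ {d e} p → d ℕ.≤ e → DegreeAtMost d p → DegreeAtMost e p
  DegreeAtMost-mono p d≤e p≤d k e<k = p≤d k (ℕ.≤-<-trans d≤e e<k)

  DegreeAtMost-resp-≋ : ∀ p q {d} → p ≋ q → DegreeAtMost d p → DegreeAtMost d q
  DegreeAtMost-resp-≋ p q p≋q p≤d k d<k = trans (sym (p≋q k)) (p≤d k d<k)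

  HasDegree-resp-≋ : ∀ p q {d} → p ≋ q → HasDegree d p → HasDegree d q
  HasDegree-resp-≋ p q p≋q (p[d]≢0 , p≤d) = (λ q[d]≡0 → p[d]≢0 (trans (p≋q _) q[d]≡0)) , DegreeAtMost-resp-≋ p q p≋q p≤d

  ⊠-DegreeAtMost : ∀ p q d e → DegreeAtMost d p → DegreeAtMost e q →
                   DegreeAtMost (d ℕ.+ e) (p ⊠ q) × coeff (p ⊠ q) (d ℕ.+ e) ≡ coeff p d * coeff q e
  ⊠-DegreeAtMost [] q d e p≤d q≤e = (λ _ _ → refl) , sym (zeroˡ _)
  ⊠-DegreeAtMost (a ∷ p) q zero e p≤0 q≤e = pq≤e , pq[e]
    where
    0∷pq≡0 : IsZero (0# ∷ (p ⊠ q))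
    0∷pq≡0 = 0∷-IsZero (IsZero-⊠ˡ p q (λ k → p≤0 (suc k) (s≤s z≤n)))
    pq≤e : DegreeAtMost e ((a ∷ p) ⊠ q)
    pq≤e k e<k = trans (coeff-∷-⊠ a p q k)
      (trans (cong₂ _+_ (trans (cong (a *_) (q≤e k e<k)) (zeroʳ a)) (0∷pq≡0 k)) (+-identityˡ _))
    pq[e] : coeff ((a ∷ p) ⊠ q) e ≡ a * coeff q e
    pq[e] = trans (coeff-∷-⊠ a p q e) (trans (cong (a * coeff q e +_) (0∷pq≡0 e)) (+-identityʳ _))
  ⊠-DegreeAtMost (a ∷ p) q (suc d) e p≤1+d q≤e = pq≤1+d+e , pq[1+d+e]
    where
    ih = ⊠-DegreeAtMost p q d e (λ k d<k → p≤1+d (suc k) (s≤s d<k)) q≤e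
    a*q[1+k]≡0 : ∀ k → d ℕ.+ e ℕ.≤ k → a * coeff q (suc k) ≡ 0#
    a*q[1+k]≡0 k d+e≤k = trans (cong (a *_) (q≤e (suc k) (s≤s (ℕ.≤-trans (ℕ.m≤n+m e d) d+e≤k)))) (zeroʳ a)
    pq≤1+d+e : DegreeAtMost (suc d ℕ.+ e) ((a ∷ p) ⊠ q)
    pq≤1+d+e (suc k) (s≤s d+e<k) = trans (coeff-∷-⊠ a p q (suc k))
      (trans (cong₂ _+_ (a*q[1+k]≡0 k (ℕ.<⇒≤ d+e<k)) (proj₁ ih k d+e<k)) (+-identityˡ _))
    pq[1+d+e] : coeff ((a ∷ p) ⊠ q) (suc d ℕ.+ e) ≡ coeff p d * coeff q e
    pq[1+d+e] = trans (coeff-∷-⊠ a p q (suc (d ℕ.+ e)))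
      (trans (cong₂ _+_ (a*q[1+k]≡0 (d ℕ.+ e) ℕ.≤-refl) (proj₂ ih)) (+-identityˡ _))

  HasDegree-⊠ : ∀ p q {d e} → HasDegree d p → HasDegree e q → HasDegree (d ℕ.+ e) (p ⊠ q)
  HasDegree-⊠ p q {d} {e} (p[d]≢0 , p≤d) (q[e]≢0 , q≤e) =
    (λ pq[d+e]≡0 → *-≢0 p[d]≢0 q[e]≢0 (trans (sym (proj₂ pq)) pq[d+e]≡0)) , proj₁ pq
    where pq = ⊠-DegreeAtMost p q d e p≤d q≤e

  ⊠≋⇒HasDegree : ∀ p q r {d e} → HasDegree d p → HasDegree e q → p ⊠ q ≋ r → HasDegree (d ℕ.+ e) r
  ⊠≋⇒HasDegree p q r deg-p deg-q pq≋r = HasDegree-resp-≋ (p ⊠ q) r pq≋r (HasDegree-⊠ p q deg-p deg-q)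

  isZero1⇒IsZero : ∀ p → isZero1 F p ≡ true → IsZero p
  isZero1⇒IsZero []      _ k = refl
  isZero1⇒IsZero (a ∷ p) e k with a ≟ 0#
  isZero1⇒IsZero (a ∷ p) e zero    | yes a≡0 = a≡0
  isZero1⇒IsZero (a ∷ p) e (suc k) | yes _   = isZero1⇒IsZero p e k

  IsZero⇒isZero1 : ∀ p → IsZero p → isZero1 F p ≡ true
  IsZero⇒isZero1 []      p≡0 = refl
  IsZero⇒isZero1 (a ∷ p) p≡0 with a ≟ 0#
  ... | yes _   = IsZero⇒isZero1 p (p≡0 ∘ suc)
  ... | no  a≢0 = ⊥-elim (a≢0 (p≡0 0))

  deg1-IsZero : ∀ p → IsZero p → deg1 F p ≡ 0
  deg1-IsZero []      p≡0 = refl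
  deg1-IsZero (a ∷ p) p≡0 rewrite IsZero⇒isZero1 p (p≡0 ∘ suc) = refl

  deg1-HasDegree : ∀ p d → HasDegree d p → deg1 F p ≡ d
  deg1-HasDegree []      d       (p[d]≢0 , _) = ⊥-elim (p[d]≢0 refl)
  deg1-HasDegree (a ∷ p) zero    (_ , p≤0) rewrite IsZero⇒isZero1 p (λ k → p≤0 (suc k) (s≤s z≤n)) = refl
  deg1-HasDegree (a ∷ p) (suc d) (p[d]≢0 , p≤d) with isZero1 F p in eq
  ... | true  = ⊥-elim (p[d]≢0 (isZero1⇒IsZero p eq d))
  ... | false = cong suc (deg1-HasDegree p d (p[d]≢0 , λ k d<k → p≤d (suc k) (s≤s d<k)))

  deg1-DegreeAtMost : ∀ p d → DegreeAtMost d p → deg1 F p ℕ.≤ d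
  deg1-DegreeAtMost p d p≤d with IsZero⊎HasDegree p
  ... | inj₁ p≡0 rewrite deg1-IsZero p p≡0 = z≤n
  ... | inj₂ (e , deg-e) rewrite deg1-HasDegree p e deg-e = HasDegree⇒≤ p deg-e p≤d

  eval-⊞ : ∀ p q t → eval (p ⊞ q) t ≡ eval p t + eval q t
  eval-⊞ []      q       t = sym (+-identityˡ _)
  eval-⊞ (a ∷ p) []      t = sym (+-identityʳ _)
  eval-⊞ (a ∷ p) (b ∷ q) t = trans (cong (λ z → a + b + t * z) (eval-⊞ p q t))
    (solve 5 (λ a b t x y → a :+ b :+ t :* (x :+ y) := a :+ t :* x :+ (b :+ t :* y)) refl a b t (eval p t) (eval q t))

  eval-map-* : ∀ a q t → eval (map (a *_) q) t ≡ a * eval q t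
  eval-map-* a []      t = sym (zeroʳ a)
  eval-map-* a (b ∷ q) t = trans (cong (λ z → a * b + t * z) (eval-map-* a q t))
    (solve 4 (λ a b t x → a :* b :+ t :* (a :* x) := a :* (b :+ t :* x)) refl a b t (eval q t))

  eval-⊠ : ∀ p q t → eval (p ⊠ q) t ≡ eval p t * eval q t
  eval-⊠ []      q t = sym (zeroˡ _)
  eval-⊠ (a ∷ p) q t = begin
    eval (map (a *_) q ⊞ (0# ∷ (p ⊠ q))) t          ≡⟨ eval-⊞ (map (a *_) q) (0# ∷ (p ⊠ q)) t ⟩
    eval (map (a *_) q) t + (0# + t * eval (p ⊠ q) t) ≡⟨ cong₂ _+_ (eval-map-* a q t) (trans (+-identityˡ _) (cong (t *_) (eval-⊠ p q t))) ⟩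
    a * eval q t + t * (eval p t * eval q t)       ≡⟨ solve 4 (λ a t x y → a :* y :+ t :* (x :* y) := (a :+ t :* x) :* y) refl a t (eval p t) (eval q t) ⟩
    (a + t * eval p t) * eval q t                  ∎
    where open ≡-Reasoning

  eval-IsZero : ∀ p t → IsZero p → eval p t ≡ 0#
  eval-IsZero []      t p≡0 = refl
  eval-IsZero (a ∷ p) t p≡0 =
    trans (cong₂ _+_ (p≡0 0) (trans (cong (t *_) (eval-IsZero p t (p≡0 ∘ suc))) (zeroʳ t))) (+-identityˡ _)

  eval-≋ : ∀ p q t → p ≋ q → eval p t ≡ eval q t
  eval-≋ []      q       t p≋q = sym (eval-IsZero q t (sym ∘ p≋q))
  eval-≋ (a ∷ p) []      t p≋q = eval-IsZero (a ∷ p) t p≋q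
  eval-≋ (a ∷ p) (b ∷ q) t p≋q = cong₂ _+_ (p≋q 0) (cong (t *_) (eval-≋ p q t (p≋q ∘ suc)))

  X-_ : Carrier → Poly1 F
  X- t = - t ∷ 1# ∷ []

  X-t-not-unit : ∀ t → ¬ IsUnit1 F (X- t)
  X-t-not-unit t (_ , higher≡0) = 1≢0 (higher≡0 0)

  -- Synthetic division: the coefficients of p ÷ (X - t) are the values at t of the tails of p.
  quotient : Poly1 F → Carrier → Poly1 F
  quotient []      t = []
  quotient (a ∷ p) t = eval p t ∷ quotient p t

  coeff-X-t-⊠ : ∀ t q k → coeff ((X- t) ⊠ q) (suc k) ≡ - t * coeff q (suc k) + coeff q k
  coeff-X-t-⊠ t q k = trans (coeff-∷-⊠ (- t) (1# ∷ []) q (suc k)) (cong (- t * coeff q (suc k) +_) (⊠-identityˡ q k))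

  synthetic-division₀ : ∀ t p → coeff ((X- t) ⊠ quotient p t) 0 + eval p t ≡ coeff p 0
  synthetic-division₀ t [] = trans (+-identityʳ _) (trans (coeff-∷-⊠ (- t) (1# ∷ []) [] 0) (trans (+-identityʳ _) (zeroʳ _)))
  synthetic-division₀ t (a ∷ p) = begin
    coeff ((X- t) ⊠ quotient (a ∷ p) t) 0 + (a + t * eval p t)  ≡⟨ cong (_+ (a + t * eval p t)) (trans (coeff-∷-⊠ (- t) (1# ∷ []) (quotient (a ∷ p) t) 0) (+-identityʳ _)) ⟩
    - t * eval p t + (a + t * eval p t)                         ≡⟨ solve 4 (λ n t e a → n :* e :+ (a :+ t :* e) := a :+ (n :+ t) :* e) refl (- t) t (eval p t) a ⟩
    a + (- t + t) * eval p t                                    ≡⟨ cong (λ z → a + z * eval p t) (-‿inverseˡ t) ⟩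
    a + 0# * eval p t                                           ≡⟨ trans (cong (a +_) (zeroˡ _)) (+-identityʳ a) ⟩
    a                                                           ∎
    where open ≡-Reasoning

  synthetic-divisionₛ : ∀ t p k → coeff ((X- t) ⊠ quotient p t) (suc k) ≡ coeff p (suc k)
  synthetic-divisionₛ t []      k       = trans (coeff-X-t-⊠ t [] k) (trans (+-identityʳ _) (zeroʳ _))
  synthetic-divisionₛ t (a ∷ p) zero    = trans (coeff-X-t-⊠ t (quotient (a ∷ p) t) 0)
    (trans (cong (_+ eval p t) (sym (trans (coeff-∷-⊠ (- t) (1# ∷ []) (quotient p t) 0) (+-identityʳ _))))
           (synthetic-division₀ t p))
  synthetic-divisionₛ t (a ∷ p) (suc k) = trans (coeff-X-t-⊠ t (quotient (a ∷ p) t) (suc k))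
    (trans (sym (coeff-X-t-⊠ t (quotient p t) k)) (synthetic-divisionₛ t p k))

  root⇒X-t-divides : ∀ {t} p → eval p t ≡ 0# → Divides1 F (X- t) p
  root⇒X-t-divides {t} p p[t]≡0 = quotient p t , λ
    { zero    → trans (sym (+-identityʳ _)) (trans (cong (coeff ((X- t) ⊠ quotient p t) 0 +_) (sym p[t]≡0)) (synthetic-division₀ t p))
    ; (suc k) → synthetic-divisionₛ t p k }

  -- Binary forms and their dehomogenisation f ↦ f(1, t)

  infixl 6 _⊞₂_
  infixl 7 _⊠₂_
  _⊞₂_ : Poly2 F → Poly2 F → Poly2 F
  _⊞₂_ = _+₂_ F
  _⊠₂_ : Poly2 F → Poly2 F → Poly2 F
  _⊠₂_ = _*₂_ F
  coeff₂ : Poly2 F → ℕ → ℕ → Carrier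
  coeff₂ = coeff2 F
  coeffˣ : Poly2 F → ℕ → Poly1 F
  coeffˣ = coeffX F
  dehom : Poly2 F → Poly1 F
  dehom = atX1 F
  eval₂ : Poly2 F → Carrier → Carrier → Carrier
  eval₂ = eval2 F

  coeff₂-⊞₂ : ∀ p q i j → coeff₂ (p ⊞₂ q) i j ≡ coeff₂ p i j + coeff₂ q i j
  coeff₂-⊞₂ []      q       i       j = sym (+-identityˡ _)
  coeff₂-⊞₂ (a ∷ p) []      i       j = sym (+-identityʳ _)
  coeff₂-⊞₂ (a ∷ p) (b ∷ q) zero    j = coeff-⊞ a b j
  coeff₂-⊞₂ (a ∷ p) (b ∷ q) (suc i) j = coeff₂-⊞₂ p q i j

  coeff₂-map-⊠ : ∀ a q i j → coeff₂ (map (a ⊠_) q) i j ≡ coeff (a ⊠ coeffˣ q i) j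
  coeff₂-map-⊠ a []      i       j = sym (IsZero-⊠ʳ a [] (λ _ → refl) j)
  coeff₂-map-⊠ a (r ∷ q) zero    j = refl
  coeff₂-map-⊠ a (r ∷ q) (suc i) j = coeff₂-map-⊠ a q i j

  coeff₂-∷-⊠₂ : ∀ a p q i j → coeff₂ ((a ∷ p) ⊠₂ q) i j ≡ coeff (a ⊠ coeffˣ q i) j + coeff₂ ([] ∷ (p ⊠₂ q)) i j
  coeff₂-∷-⊠₂ a p q i j = trans (coeff₂-⊞₂ (map (a ⊠_) q) ([] ∷ (p ⊠₂ q)) i j) (cong (_+ _) (coeff₂-map-⊠ a q i j))

  dehom-⊞₂ : ∀ p q → dehom (p ⊞₂ q) ≋ dehom p ⊞ dehom q
  dehom-⊞₂ []      q       k = refl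
  dehom-⊞₂ (a ∷ p) []      k = sym (trans (coeff-⊞ (dehom (a ∷ p)) [] k) (+-identityʳ _))
  dehom-⊞₂ (a ∷ p) (b ∷ q) k = begin
    coeff ((a ⊞ b) ⊞ dehom (p ⊞₂ q)) k
      ≡⟨ coeff-⊞ (a ⊞ b) (dehom (p ⊞₂ q)) k ⟩
    coeff (a ⊞ b) k + coeff (dehom (p ⊞₂ q)) k
      ≡⟨ cong₂ _+_ (coeff-⊞ a b k) (trans (dehom-⊞₂ p q k) (coeff-⊞ (dehom p) (dehom q) k)) ⟩
    coeff a k + coeff b k + (coeff (dehom p) k + coeff (dehom q) k)
      ≡⟨ solve 4 (λ a b x y → a :+ b :+ (x :+ y) := a :+ x :+ (b :+ y)) refl
                 (coeff a k) (coeff b k) (coeff (dehom p) k) (coeff (dehom q) k) ⟩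
    coeff a k + coeff (dehom p) k + (coeff b k + coeff (dehom q) k)
      ≡⟨ cong₂ _+_ (coeff-⊞ a (dehom p) k) (coeff-⊞ b (dehom q) k) ⟨
    coeff (a ⊞ dehom p) k + coeff (b ⊞ dehom q) k
      ≡⟨ coeff-⊞ (a ⊞ dehom p) (b ⊞ dehom q) k ⟨
    coeff ((a ⊞ dehom p) ⊞ (b ⊞ dehom q)) k
      ∎
    where open ≡-Reasoning

  dehom-map-⊠ : ∀ a q → dehom (map (a ⊠_) q) ≋ a ⊠ dehom q
  dehom-map-⊠ a []      k = sym (IsZero-⊠ʳ a [] (λ _ → refl) k)
  dehom-map-⊠ a (r ∷ q) k = begin
    coeff (a ⊠ r ⊞ dehom (map (a ⊠_) q)) k     ≡⟨ coeff-⊞ (a ⊠ r) (dehom (map (a ⊠_) q)) k ⟩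
    coeff (a ⊠ r) k + coeff (dehom (map (a ⊠_) q)) k ≡⟨ cong (coeff (a ⊠ r) k +_) (dehom-map-⊠ a q k) ⟩
    coeff (a ⊠ r) k + coeff (a ⊠ dehom q) k    ≡⟨ coeff-⊞ (a ⊠ r) (a ⊠ dehom q) k ⟨
    coeff (a ⊠ r ⊞ a ⊠ dehom q) k              ≡⟨ ⊠-distribˡ-⊞ a r (dehom q) k ⟨
    coeff (a ⊠ (r ⊞ dehom q)) k                ∎
    where open ≡-Reasoning

  dehom-⊠₂ : ∀ p q → dehom (p ⊠₂ q) ≋ dehom p ⊠ dehom q
  dehom-⊠₂ []      q k = refl
  dehom-⊠₂ (a ∷ p) q k = begin
    coeff (dehom (map (a ⊠_) q ⊞₂ ([] ∷ (p ⊠₂ q)))) k            ≡⟨ dehom-⊞₂ (map (a ⊠_) q) ([] ∷ (p ⊠₂ q)) k ⟩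
    coeff (dehom (map (a ⊠_) q) ⊞ dehom (p ⊠₂ q)) k              ≡⟨ coeff-⊞ (dehom (map (a ⊠_) q)) (dehom (p ⊠₂ q)) k ⟩
    coeff (dehom (map (a ⊠_) q)) k + coeff (dehom (p ⊠₂ q)) k    ≡⟨ cong₂ _+_ (dehom-map-⊠ a q k) (dehom-⊠₂ p q k) ⟩
    coeff (a ⊠ dehom q) k + coeff (dehom p ⊠ dehom q) k          ≡⟨ coeff-⊞ (a ⊠ dehom q) (dehom p ⊠ dehom q) k ⟨
    coeff (a ⊠ dehom q ⊞ dehom p ⊠ dehom q) k                    ≡⟨ ⊠-distribʳ-⊞ (dehom q) a (dehom p) k ⟨
    coeff ((a ⊞ dehom p) ⊠ dehom q) k                            ∎
    where open ≡-Reasoning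

  -- y ^ u * a is zero or a monomial of degree k; x ^ s * p is zero or a form of degree N.
  ShiftedMonomial : ℕ → ℕ → Poly1 F → Set
  ShiftedMonomial u k a = ∀ j → u ℕ.+ j ≢ k → coeff a j ≡ 0#

  ShiftedHomogeneous : ℕ → ℕ → Poly2 F → Set
  ShiftedHomogeneous s N p = ∀ i j → s ℕ.+ i ℕ.+ j ≢ N → coeff₂ p i j ≡ 0#

  Homogeneous : ℕ → Poly2 F → Set
  Homogeneous = ShiftedHomogeneous 0

  ShiftedMonomial-head : ∀ {u k a p} → ShiftedMonomial u k (a ∷ p) → u ≢ k → a ≡ 0#
  ShiftedMonomial-head {u} mono u≢k = mono 0 (λ u+0≡k → u≢k (trans (sym (ℕ.+-identityʳ u)) u+0≡k))

  ShiftedMonomial-tail : ∀ {u k a p} → ShiftedMonomial u k (a ∷ p) → ShiftedMonomial (suc u) k p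
  ShiftedMonomial-tail {u} mono j 1+u+j≢k = mono (suc j) (λ u+1+j≡k → 1+u+j≢k (trans (sym (ℕ.+-suc u j)) u+1+j≡k))

  ShiftedHomogeneous-head : ∀ {s N a p} → ShiftedHomogeneous s N (a ∷ p) → ShiftedMonomial s N a
  ShiftedHomogeneous-head {s} hom j s+j≢N = hom 0 j (λ s+0+j≡N → s+j≢N (trans (cong (ℕ._+ j) (sym (ℕ.+-identityʳ s))) s+0+j≡N))

  ShiftedHomogeneous-tail : ∀ {s N a p} → ShiftedHomogeneous s N (a ∷ p) → ShiftedHomogeneous (suc s) N p
  ShiftedHomogeneous-tail {s} hom i j ne = hom (suc i) j (λ e → ne (trans (cong (ℕ._+ j) (sym (ℕ.+-suc s i))) e))

  ShiftedMonomial-⊠ : ∀ a b {u v k l} → ShiftedMonomial u k a → ShiftedMonomial v l b →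
                      ShiftedMonomial (u ℕ.+ v) (k ℕ.+ l) (a ⊠ b)
  ShiftedMonomial-⊠ []      b mono-a mono-b j ne = refl
  ShiftedMonomial-⊠ (c ∷ a) b {u} {v} {k} {l} mono-a mono-b j ne = begin
    coeff ((c ∷ a) ⊠ b) j                      ≡⟨ coeff-∷-⊠ c a b j ⟩
    c * coeff b j + coeff (0# ∷ (a ⊠ b)) j     ≡⟨ cong₂ _+_ head-term (tail-term j ne) ⟩
    0# + 0#                                    ≡⟨ +-identityˡ 0# ⟩
    0#                                         ∎
    where
    open ≡-Reasoning
    head-term : c * coeff b j ≡ 0#
    head-term with u ℕ.≟ k
    ... | yes refl = trans (cong (c *_) (mono-b j (λ v+j≡l → ne (trans (ℕ.+-assoc u v j) (cong (u ℕ.+_) v+j≡l))))) (zeroʳ c)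
    ... | no  u≢k  = trans (cong (_* coeff b j) (ShiftedMonomial-head mono-a u≢k)) (zeroˡ _)
    tail-term : ∀ j → u ℕ.+ v ℕ.+ j ≢ k ℕ.+ l → coeff (0# ∷ (a ⊠ b)) j ≡ 0#
    tail-term zero    _  = refl
    tail-term (suc j) ne′ = ShiftedMonomial-⊠ a b (ShiftedMonomial-tail mono-a) mono-b j
      (λ e → ne′ (trans (ℕ.+-suc (u ℕ.+ v) j) e))

  ShiftedHomogeneous-⊠₂ : ∀ p q {s k l} → ShiftedHomogeneous s k p → Homogeneous l q →
                          ShiftedHomogeneous s (k ℕ.+ l) (p ⊠₂ q)
  ShiftedHomogeneous-⊠₂ []      q hom-p hom-q i j ne = refl
  ShiftedHomogeneous-⊠₂ (a ∷ p) q {s} {k} {l} hom-p hom-q i j ne = begin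
    coeff₂ ((a ∷ p) ⊠₂ q) i j                                ≡⟨ coeff₂-∷-⊠₂ a p q i j ⟩
    coeff (a ⊠ coeffˣ q i) j + coeff₂ ([] ∷ (p ⊠₂ q)) i j    ≡⟨ cong₂ _+_ head-term (tail-term i ne) ⟩
    0# + 0#                                                  ≡⟨ +-identityˡ 0# ⟩
    0#                                                       ∎
    where
    open ≡-Reasoning
    head-term : coeff (a ⊠ coeffˣ q i) j ≡ 0#
    head-term = ShiftedMonomial-⊠ a (coeffˣ q i) (ShiftedHomogeneous-head hom-p) (hom-q i) j ne
    tail-term : ∀ i → s ℕ.+ i ℕ.+ j ≢ k ℕ.+ l → coeff₂ ([] ∷ (p ⊠₂ q)) i j ≡ 0#
    tail-term zero    _   = refl
    tail-term (suc i) ne′ = ShiftedHomogeneous-⊠₂ p q (ShiftedHomogeneous-tail hom-p) hom-q i j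
      (λ e → ne′ (trans (cong (ℕ._+ j) (ℕ.+-suc s i)) e))

  ShiftedHomogeneous⇒dehom-vanishes : ∀ p {s N} → ShiftedHomogeneous s N p → ∀ j → N ℕ.< s ℕ.+ j → coeff (dehom p) j ≡ 0#
  ShiftedHomogeneous⇒dehom-vanishes []      hom j N<s+j = refl
  ShiftedHomogeneous⇒dehom-vanishes (a ∷ p) hom j N<s+j = begin
    coeff (a ⊞ dehom p) j               ≡⟨ coeff-⊞ a (dehom p) j ⟩
    coeff a j + coeff (dehom p) j       ≡⟨ cong₂ _+_ (ShiftedHomogeneous-head hom j (λ s+j≡N → ℕ.<-irrefl (sym s+j≡N) N<s+j))
                                                     (ShiftedHomogeneous⇒dehom-vanishes p (ShiftedHomogeneous-tail hom) j (ℕ.m<n⇒m<1+n N<s+j)) ⟩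
    0# + 0#                             ≡⟨ +-identityˡ 0# ⟩
    0#                                  ∎
    where open ≡-Reasoning

  Homogeneous⇒dehom-DegreeAtMost : ∀ {N} p → Homogeneous N p → DegreeAtMost N (dehom p)
  Homogeneous⇒dehom-DegreeAtMost p = ShiftedHomogeneous⇒dehom-vanishes p

  coeff-dehom : ∀ p {s N} → ShiftedHomogeneous s N p → ∀ i j → s ℕ.+ i ℕ.+ j ≡ N → coeff (dehom p) j ≡ coeff₂ p i j
  coeff-dehom []      hom i j _ = refl
  coeff-dehom (a ∷ p) {s} {N} hom zero j s+0+j≡N = begin
    coeff (a ⊞ dehom p) j               ≡⟨ coeff-⊞ a (dehom p) j ⟩
    coeff a j + coeff (dehom p) j       ≡⟨ cong (coeff a j +_) (ShiftedHomogeneous⇒dehom-vanishes p (ShiftedHomogeneous-tail hom) j N<1+s+j) ⟩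
    coeff a j + 0#                      ≡⟨ +-identityʳ _ ⟩
    coeff a j                           ∎
    where
    open ≡-Reasoning
    N<1+s+j : N ℕ.< suc s ℕ.+ j
    N<1+s+j = subst (ℕ._< suc (s ℕ.+ j)) (trans (cong (ℕ._+ j) (sym (ℕ.+-identityʳ s))) s+0+j≡N) (ℕ.n<1+n _)
  coeff-dehom (a ∷ p) {s} {N} hom (suc i) j s+1+i+j≡N = begin
    coeff (a ⊞ dehom p) j               ≡⟨ coeff-⊞ a (dehom p) j ⟩
    coeff a j + coeff (dehom p) j       ≡⟨ cong₂ _+_ (ShiftedHomogeneous-head hom j s+j≢N)
                                                     (coeff-dehom p (ShiftedHomogeneous-tail hom) i j (trans (cong (ℕ._+ j) (sym (ℕ.+-suc s i))) s+1+i+j≡N)) ⟩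
    0# + coeff₂ p i j                   ≡⟨ +-identityˡ _ ⟩
    coeff₂ p i j                        ∎
    where
    open ≡-Reasoning
    s+j≢N : s ℕ.+ j ≢ N
    s+j≢N s+j≡N = ℕ.<-irrefl (trans s+j≡N (sym s+1+i+j≡N)) (ℕ.+-monoˡ-< j (ℕ.m<m+n s (s≤s z≤n)))

  Homogeneous-dehom-injective : ∀ p q {N} → Homogeneous N p → Homogeneous N q → dehom p ≋ dehom q →
                                ∀ i j → coeff₂ p i j ≡ coeff₂ q i j
  Homogeneous-dehom-injective p q {N} hom-p hom-q p≋q i j with i ℕ.+ j ℕ.≟ N
  ... | yes i+j≡N = trans (sym (coeff-dehom p hom-p i j i+j≡N)) (trans (p≋q j) (coeff-dehom q hom-q i j i+j≡N))
  ... | no  i+j≢N = trans (hom-p i j i+j≢N) (sym (hom-q i j i+j≢N))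

  coeffˣ-tabulate : ∀ {n} (f : Fin n → Poly1 F) (i : Fin n) → coeffˣ (tabulate f) (toℕ i) ≡ f i
  coeffˣ-tabulate f Fin.zero    = refl
  coeffˣ-tabulate f (Fin.suc i) = coeffˣ-tabulate (f ∘ Fin.suc) i

  coeffˣ-tabulate-beyond : ∀ {n} (f : Fin n → Poly1 F) k → n ℕ.≤ k → coeffˣ (tabulate f) k ≡ []
  coeffˣ-tabulate-beyond {zero}  f k       _         = refl
  coeffˣ-tabulate-beyond {suc n} f (suc k) (s≤s n≤k) = coeffˣ-tabulate-beyond (f ∘ Fin.suc) k n≤k

  coeff-yMono : ∀ k v → coeff (yMono F k v) k ≡ v
  coeff-yMono zero    v = refl
  coeff-yMono (suc k) v = coeff-yMono k v

  coeff-yMono-≢ : ∀ k v j → j ≢ k → coeff (yMono F k v) j ≡ 0#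
  coeff-yMono-≢ zero    v zero    j≢k = ⊥-elim (j≢k refl)
  coeff-yMono-≢ zero    v (suc j) j≢k = refl
  coeff-yMono-≢ (suc k) v zero    j≢k = refl
  coeff-yMono-≢ (suc k) v (suc j) j≢k = coeff-yMono-≢ k v j (j≢k ∘ cong suc)

  eval-yMono : ∀ k v y → eval (yMono F k v) y ≡ y ^ k * v
  eval-yMono zero    v y = trans (cong (v +_) (zeroʳ y)) (trans (+-identityʳ v) (sym (*-identityˡ v)))
  eval-yMono (suc k) v y = trans (+-identityˡ _) (trans (cong (y *_) (eval-yMono k v y)) (sym (*-assoc _ _ _)))

  coeffˣ-homForm : ∀ d c (i : Fin (suc d)) → coeffˣ (homForm F d c) (toℕ i) ≡ yMono F (toℕ (opposite i)) (c (opposite i))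
  coeffˣ-homForm d c = coeffˣ-tabulate (λ i → yMono F (toℕ (opposite i)) (c (opposite i)))

  homForm-Homogeneous : ∀ d c → Homogeneous d (homForm F d c)
  homForm-Homogeneous d c i j i+j≢d with i ℕ.<? suc d
  ... | no  i≮1+d = cong (λ r → coeff r j)
    (coeffˣ-tabulate-beyond (λ i → yMono F (toℕ (opposite i)) (c (opposite i))) i (ℕ.≮⇒≥ i≮1+d))
  ... | yes i<1+d = begin
    coeff (coeffˣ (homForm F d c) i) j            ≡⟨ cong (λ k → coeff (coeffˣ (homForm F d c) k) j) (sym (Fin.toℕ-fromℕ< i<1+d)) ⟩
    coeff (coeffˣ (homForm F d c) (toℕ ι)) j      ≡⟨ cong (λ r → coeff r j) (coeffˣ-homForm d c ι) ⟩
    coeff (yMono F (toℕ (opposite ι)) _) j        ≡⟨ coeff-yMono-≢ _ _ j j≢d∸i ⟩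
    0#                                            ∎
    where
    open ≡-Reasoning
    ι = fromℕ< i<1+d
    j≢d∸i : j ≢ toℕ (opposite ι)
    j≢d∸i j≡ = i+j≢d (trans (cong (i ℕ.+_) (trans j≡ (trans (Fin.opposite-prop ι) (cong (d ℕ.∸_) (Fin.toℕ-fromℕ< i<1+d)))))
                            (ℕ.m+[n∸m]≡n (ℕ.≤-pred i<1+d)))

  coeff₂-homForm : ∀ d c (j : Fin (suc d)) i → i ℕ.+ toℕ j ≡ d → coeff₂ (homForm F d c) i (toℕ j) ≡ c j
  coeff₂-homForm d c j i i+j≡d = begin
    coeff (coeffˣ (homForm F d c) i) (toℕ j)               ≡⟨ cong (λ k → coeff (coeffˣ (homForm F d c) k) (toℕ j)) (sym (Fin.toℕ-fromℕ< i<1+d)) ⟩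
    coeff (coeffˣ (homForm F d c) (toℕ ι)) (toℕ j)         ≡⟨ cong (λ r → coeff r (toℕ j)) (coeffˣ-homForm d c ι) ⟩
    coeff (yMono F (toℕ (opposite ι)) (c (opposite ι))) (toℕ j) ≡⟨ cong (λ k → coeff (yMono F (toℕ k) (c k)) (toℕ j)) opposite-ι≡j ⟩
    coeff (yMono F (toℕ j) (c j)) (toℕ j)                  ≡⟨ coeff-yMono (toℕ j) (c j) ⟩
    c j                                                    ∎
    where
    open ≡-Reasoning
    i<1+d : i ℕ.< suc d
    i<1+d = s≤s (subst (i ℕ.≤_) i+j≡d (ℕ.m≤m+n i (toℕ j)))
    ι = fromℕ< i<1+d
    opposite-ι≡j : opposite ι ≡ j
    opposite-ι≡j = Fin.toℕ-injective (begin
      toℕ (opposite ι)       ≡⟨ Fin.opposite-prop ι ⟩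
      d ℕ.∸ toℕ ι            ≡⟨ cong (d ℕ.∸_) (Fin.toℕ-fromℕ< i<1+d) ⟩
      d ℕ.∸ i                ≡⟨ cong (ℕ._∸ i) (sym i+j≡d) ⟩
      i ℕ.+ toℕ j ℕ.∸ i      ≡⟨ ℕ.m+n∸m≡n i (toℕ j) ⟩
      toℕ j                  ∎)

  coeff-dehom-homForm : ∀ d c (j : Fin (suc d)) → coeff (dehom (homForm F d c)) (toℕ j) ≡ c j
  coeff-dehom-homForm d c j = trans (coeff-dehom (homForm F d c) (homForm-Homogeneous d c) (d ℕ.∸ toℕ j) (toℕ j) d∸j+j≡d)
                                    (coeff₂-homForm d c j (d ℕ.∸ toℕ j) d∸j+j≡d)
    where
    d∸j+j≡d : d ℕ.∸ toℕ j ℕ.+ toℕ j ≡ d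
    d∸j+j≡d = ℕ.m∸n+n≡m (Fin.toℕ≤pred[n] j)

  coeff-dehom-homForm-top : ∀ d c → coeff (dehom (homForm F d c)) d ≡ c (Fin.fromℕ d)
  coeff-dehom-homForm-top d c = subst (λ k → coeff (dehom (homForm F d c)) k ≡ c (Fin.fromℕ d)) (Fin.toℕ-fromℕ d)
                                      (coeff-dehom-homForm d c (Fin.fromℕ d))

  eval₂-homForm-x≡0 : ∀ d c y → eval₂ (homForm F d c) 0# y ≡ y ^ d * c (Fin.fromℕ d)
  eval₂-homForm-x≡0 d c y = begin
    eval (yMono F (toℕ top) (c top)) y + 0# * _   ≡⟨ trans (cong (eval (yMono F (toℕ top) (c top)) y +_) (zeroˡ _)) (+-identityʳ _) ⟩
    eval (yMono F (toℕ top) (c top)) y            ≡⟨ eval-yMono (toℕ top) (c top) y ⟩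
    y ^ toℕ top * c top                           ≡⟨ cong (λ k → y ^ k * c top) (Fin.toℕ-fromℕ d) ⟩
    y ^ d * c top                                 ∎
    where
    open ≡-Reasoning
    top = Fin.fromℕ d

  eval₂-homForm-constant : ∀ c x y → eval₂ (homForm F 0 c) x y ≡ c Fin.zero
  eval₂-homForm-constant c x y =
    trans (cong₂ _+_ (trans (cong (c Fin.zero +_) (zeroʳ y)) (+-identityʳ _)) (zeroʳ x)) (+-identityʳ _)

  eval₂-x≡1 : ∀ p t → eval₂ p 1# t ≡ eval (dehom p) t
  eval₂-x≡1 []      t = refl
  eval₂-x≡1 (a ∷ p) t = trans (cong (eval a t +_) (trans (*-identityˡ _) (eval₂-x≡1 p t))) (sym (eval-⊞ a (dehom p) t))

  ShiftedMonomial-eval : ∀ a {u k} l y → ShiftedMonomial u k a → l ^ u * eval a (l * y) ≡ l ^ k * eval a y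
  ShiftedMonomial-eval []      l y mono = trans (zeroʳ _) (sym (zeroʳ _))
  ShiftedMonomial-eval (c ∷ a) {u} {k} l y mono = begin
    l ^ u * (c + l * y * eval a (l * y))           ≡⟨ solve 5 (λ l lᵘ c y v → lᵘ :* (c :+ l :* y :* v) := lᵘ :* c :+ y :* (l :* lᵘ :* v))
                                                             refl l (l ^ u) c y (eval a (l * y)) ⟩
    l ^ u * c + y * (l ^ suc u * eval a (l * y))   ≡⟨ cong₂ (λ z w → z + y * w) head-term (ShiftedMonomial-eval a l y (ShiftedMonomial-tail mono)) ⟩
    l ^ k * c + y * (l ^ k * eval a y)             ≡⟨ solve 4 (λ lᵏ c y v → lᵏ :* c :+ y :* (lᵏ :* v) := lᵏ :* (c :+ y :* v)) refl (l ^ k) c y (eval a y) ⟩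
    l ^ k * (c + y * eval a y)                     ∎
    where
    open ≡-Reasoning
    head-term : l ^ u * c ≡ l ^ k * c
    head-term with u ℕ.≟ k
    ... | yes refl = refl
    ... | no  u≢k  = trans (cong (l ^ u *_) c≡0) (trans (zeroʳ _) (sym (trans (cong (l ^ k *_) c≡0) (zeroʳ _))))
      where
      c≡0 : c ≡ 0#
      c≡0 = ShiftedMonomial-head mono u≢k

  ShiftedHomogeneous-eval₂ : ∀ p {s N} l x y → ShiftedHomogeneous s N p → l ^ s * eval₂ p (l * x) (l * y) ≡ l ^ N * eval₂ p x y
  ShiftedHomogeneous-eval₂ []      l x y hom = trans (zeroʳ _) (sym (zeroʳ _))
  ShiftedHomogeneous-eval₂ (a ∷ p) {s} {N} l x y hom = begin
    l ^ s * (eval a (l * y) + l * x * eval₂ p (l * x) (l * y))            ≡⟨ solve 5 (λ l lˢ A x v → lˢ :* (A :+ l :* x :* v) := lˢ :* A :+ x :* (l :* lˢ :* v))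
                                                                                   refl l (l ^ s) (eval a (l * y)) x (eval₂ p (l * x) (l * y)) ⟩
    l ^ s * eval a (l * y) + x * (l ^ suc s * eval₂ p (l * x) (l * y))   ≡⟨ cong₂ (λ z w → z + x * w) (ShiftedMonomial-eval a l y (ShiftedHomogeneous-head hom))
                                                                                   (ShiftedHomogeneous-eval₂ p l x y (ShiftedHomogeneous-tail hom)) ⟩
    l ^ N * eval a y + x * (l ^ N * eval₂ p x y)                          ≡⟨ solve 4 (λ lᴺ A x v → lᴺ :* A :+ x :* (lᴺ :* v) := lᴺ :* (A :+ x :* v))
                                                                                   refl (l ^ N) (eval a y) x (eval₂ p x y) ⟩
    l ^ N * (eval a y + x * eval₂ p x y)                                  ∎
    where open ≡-Reasoning

  eval₂-homogeneous : ∀ p {N} l x y → Homogeneous N p → eval₂ p (l * x) (l * y) ≡ l ^ N * eval₂ p x y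
  eval₂-homogeneous p l x y hom = trans (sym (*-identityˡ _)) (ShiftedHomogeneous-eval₂ p l x y hom)

  eval₂-dehom : ∀ p {N x} y → Homogeneous N p → x ≢ 0# → eval₂ p x y ≡ x ^ N * eval (dehom p) (y * x ⁻¹)
  eval₂-dehom p {N} {x} y hom x≢0 = begin
    eval₂ p x y                                 ≡⟨ cong₂ (eval₂ p) (sym (*-identityʳ x)) y≡x[y/x] ⟩
    eval₂ p (x * 1#) (x * (y * x ⁻¹))           ≡⟨ eval₂-homogeneous p x 1# (y * x ⁻¹) hom ⟩
    x ^ N * eval₂ p 1# (y * x ⁻¹)               ≡⟨ cong (x ^ N *_) (eval₂-x≡1 p (y * x ⁻¹)) ⟩
    x ^ N * eval (dehom p) (y * x ⁻¹)           ∎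
    where
    open ≡-Reasoning
    y≡x[y/x] : y ≡ x * (y * x ⁻¹)
    y≡x[y/x] = sym (trans (*-comm x _) (/-*-cancel y x≢0))

  eval₂-product-homogeneous : ∀ p q {d e} l x y → Homogeneous d p → Homogeneous e q →
    eval₂ p (l * x) (l * y) * eval₂ q (l * x) (l * y) ≡ l ^ (e ℕ.+ d) * (eval₂ p x y * eval₂ q x y)
  eval₂-product-homogeneous p q {d} {e} l x y hom-p hom-q = begin
    eval₂ p (l * x) (l * y) * eval₂ q (l * x) (l * y)   ≡⟨ cong₂ _*_ (eval₂-homogeneous p l x y hom-p) (eval₂-homogeneous q l x y hom-q) ⟩
    l ^ d * eval₂ p x y * (l ^ e * eval₂ q x y)         ≡⟨ solve 4 (λ a u b v → a :* u :* (b :* v) := b :* a :* (u :* v)) refl (l ^ d) (eval₂ p x y) (l ^ e) (eval₂ q x y) ⟩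
    l ^ e * l ^ d * (eval₂ p x y * eval₂ q x y)         ≡⟨ cong (_* _) (^-homo-* l e d) ⟨
    l ^ (e ℕ.+ d) * (eval₂ p x y * eval₂ q x y)         ∎
    where open ≡-Reasoning

  eval₂-homForm-origin : ∀ d c → eval₂ (homForm F (suc d) c) 0# 0# ≡ 0#
  eval₂-homForm-origin d c = trans (eval₂-homForm-x≡0 (suc d) c 0#) (trans (cong (_* _) (zeroˡ _)) (zeroˡ _))

  homogenize : ℕ → Poly1 F → Poly2 F
  homogenize k d = homForm F k (λ j → coeff d (toℕ j))

  homogenize-Homogeneous : ∀ k d → Homogeneous k (homogenize k d)
  homogenize-Homogeneous k d = homForm-Homogeneous k (λ j → coeff d (toℕ j))

  coeff₂-homogenize : ∀ k d (j : Fin (suc k)) i → i ℕ.+ toℕ j ≡ k → coeff₂ (homogenize k d) i (toℕ j) ≡ coeff d (toℕ j)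
  coeff₂-homogenize k d = coeff₂-homForm k (λ j → coeff d (toℕ j))

  dehom-homogenize : ∀ k d → DegreeAtMost k d → dehom (homogenize k d) ≋ d
  dehom-homogenize k d d≤k j with j ℕ.≤? k
  ... | yes j≤k = subst (λ i → coeff (dehom (homogenize k d)) i ≡ coeff d i) (Fin.toℕ-fromℕ< (s≤s j≤k))
                        (coeff-dehom-homForm k (λ i → coeff d (toℕ i)) (fromℕ< (s≤s j≤k)))
  ... | no  j≰k = trans (Homogeneous⇒dehom-DegreeAtMost (homogenize k d) (homogenize-Homogeneous k d) j (ℕ.≰⇒> j≰k))
                        (sym (d≤k j (ℕ.≰⇒> j≰k)))

  -- D ⊠ H and f are forms of the same degree with the same dehomogenisation.
  homogenize-divides : ∀ {N k l} d h f → Homogeneous N f → DegreeAtMost k d → DegreeAtMost l h → k ℕ.+ l ≡ N →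
                       d ⊠ h ≋ dehom f → Divides2 F (homogenize k d) f
  homogenize-divides {k = k} {l} d h f hom-f d≤k h≤l refl dh≋f =
    homogenize l h , Homogeneous-dehom-injective (D ⊠₂ H) f hom-DH hom-f dehom-DH≋f
    where
    D = homogenize k d
    H = homogenize l h
    hom-DH : Homogeneous (k ℕ.+ l) (D ⊠₂ H)
    hom-DH = ShiftedHomogeneous-⊠₂ D H (homogenize-Homogeneous k d) (homogenize-Homogeneous l h)
    dehom-DH≋f : dehom (D ⊠₂ H) ≋ dehom f
    dehom-DH≋f = ≋-trans {dehom (D ⊠₂ H)} {dehom D ⊠ dehom H} {dehom f} (dehom-⊠₂ D H)
                   (≋-trans {dehom D ⊠ dehom H} {d ⊠ h} {dehom f} (⊠-cong {dehom D} {d} {dehom H} {h} (dehom-homogenize k d d≤k) (dehom-homogenize l h h≤l)) dh≋f)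

  X : Poly2 F
  X = homogenize 1 (1# ∷ [])

  X-not-unit : ¬ IsUnit2 F X
  X-not-unit (_ , X-higher≡0) = 1≢0 (trans (sym (coeff₂-homogenize 1 (1# ∷ []) Fin.zero 1 refl)) (X-higher≡0 1 0 (λ { (() , _) })))

  X-divides : ∀ {N} f → Homogeneous (suc N) f → coeff (dehom f) (suc N) ≡ 0# → Divides2 F X f
  X-divides {N} f hom-f f[1+N]≡0 = homogenize-divides (1# ∷ []) (dehom f) f hom-f 1≤1 f≤N refl (⊠-identityˡ (dehom f))
    where
    1≤1 : DegreeAtMost 1 (1# ∷ [])
    1≤1 (suc zero)    (s≤s ())
    1≤1 (suc (suc k)) _ = refl
    f≤N : DegreeAtMost N (dehom f)
    f≤N k N<k with ℕ.m≤n⇒m<n∨m≡n N<k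
    ... | inj₁ 1+N<k = Homogeneous⇒dehom-DegreeAtMost f hom-f k 1+N<k
    ... | inj₂ refl  = f[1+N]≡0

  HasDegree-0⇒IsUnit1 : ∀ d → HasDegree 0 d → IsUnit1 F d
  HasDegree-0⇒IsUnit1 d (d[0]≢0 , d≤0) = d[0]≢0 , λ k → d≤0 (suc k) (s≤s z≤n)

  homogenize-IsUnit2⇒HasDegree-0 : ∀ d {k} → HasDegree k d → IsUnit2 F (homogenize k d) → k ≡ 0
  homogenize-IsUnit2⇒HasDegree-0 d {zero}  _             _               = refl
  homogenize-IsUnit2⇒HasDegree-0 d {suc k} (d[k]≢0 , _) (_ , D-higher≡0) = ⊥-elim (d[k]≢0 (begin
    coeff d (suc k)                                    ≡⟨ cong (coeff d) (sym (Fin.toℕ-fromℕ (suc k))) ⟩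
    coeff d (toℕ (Fin.fromℕ (suc k)))                  ≡⟨ coeff₂-homogenize (suc k) d (Fin.fromℕ (suc k)) 0 (Fin.toℕ-fromℕ (suc k)) ⟨
    coeff₂ (homogenize (suc k) d) 0 (toℕ (Fin.fromℕ (suc k))) ≡⟨ D-higher≡0 0 _ (λ { (_ , k+1≡0) → ℕ.m<n⇒n≢0 (ℕ.s≤s ℕ.z≤n) (trans (sym (Fin.toℕ-fromℕ (suc k))) k+1≡0) }) ⟩
    0#                                                 ∎))
    where open ≡-Reasoning

  quotient-DegreeAtMost : ∀ d h q {k N} → HasDegree k d → DegreeAtMost N q → d ⊠ h ≋ q → DegreeAtMost (N ℕ.∸ k) h
  quotient-DegreeAtMost d h q {k} {N} deg-d q≤N dh≋q with IsZero⊎HasDegree h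
  ... | inj₁ h≡0       = λ j _ → h≡0 j
  ... | inj₂ (l , deg-h) = DegreeAtMost-mono h l≤N∸k (proj₂ deg-h)
    where
    k+l≤N : k ℕ.+ l ℕ.≤ N
    k+l≤N = HasDegree⇒≤ q (⊠≋⇒HasDegree d h q deg-d deg-h dh≋q) q≤N
    l≤N∸k : l ℕ.≤ N ℕ.∸ k
    l≤N∸k = subst (ℕ._≤ N ℕ.∸ k) (ℕ.m+n∸m≡n k l) (ℕ.∸-monoˡ-≤ k k+l≤N)

  divisor-degree≤ : ∀ d q {k N} → HasDegree k d → HasDegree N q → Divides1 F d q → k ℕ.≤ N
  divisor-degree≤ d q {k} {N} deg-d deg-q (h , dh≋q) with IsZero⊎HasDegree h
  ... | inj₁ h≡0         = ⊥-elim (proj₁ deg-q (trans (sym (dh≋q N)) (IsZero-⊠ʳ d h h≡0 N)))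
  ... | inj₂ (l , deg-h) = ℕ.≤-trans (ℕ.m≤m+n k l)
    (HasDegree⇒≤ q (⊠≋⇒HasDegree d h q deg-d deg-h dh≋q) (proj₂ deg-q))

  coprime-forms⇒coprime-dehom : ∀ {N} f₁ f₂ → Homogeneous N f₁ → Homogeneous N f₂ → HasDegree N (dehom f₂) →
                                Coprime2 F f₁ f₂ → Coprime1 F (dehom f₁) (dehom f₂)
  coprime-forms⇒coprime-dehom {N} f₁ f₂ hom₁ hom₂ deg-f₂ coprime d d∣f₁ d∣f₂ with IsZero⊎HasDegree d
  ... | inj₁ d≡0 = ⊥-elim (proj₁ deg-f₂ (trans (sym (proj₂ d∣f₂ N)) (IsZero-⊠ˡ d _ d≡0 N)))
  ... | inj₂ (k , deg-d) with homogenize-IsUnit2⇒HasDegree-0 d deg-d (coprime (homogenize k d)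
                                 (homogenizes f₁ hom₁ d∣f₁) (homogenizes f₂ hom₂ d∣f₂))
    where
    homogenizes : ∀ f → Homogeneous N f → Divides1 F d (dehom f) → Divides2 F (homogenize k d) f
    homogenizes f hom (h , dh≋f) = homogenize-divides d h f hom (proj₂ deg-d)
      (quotient-DegreeAtMost d h (dehom f) deg-d (Homogeneous⇒dehom-DegreeAtMost f hom) dh≋f)
      (ℕ.m+[n∸m]≡n (divisor-degree≤ d (dehom f₂) deg-d deg-f₂ d∣f₂)) dh≋f
  ... | refl = HasDegree-0⇒IsUnit1 d deg-d

  -- The projective line

  NotOrigin : Carrier → Carrier → Set
  NotOrigin x y = ¬ (x ≡ 0# × y ≡ 0#)

  origin? : ∀ x y → (x ≡ 0# × y ≡ 0#) ⊎ NotOrigin x y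
  origin? x y with x ≟ 0# ×-dec y ≟ 0#
  ... | yes origin = inj₁ origin
  ... | no  ¬origin = inj₂ ¬origin

  -- The point [u : v] of P¹ in the coordinate u / v, as inducedMap computes it at finite points.
  ratio : Carrier → Carrier → P1 F
  ratio u v = if isYes (v ≟ 0#) then nothing else just (u * v ⁻¹)

  ratio-≡0 : ∀ u {v} → v ≡ 0# → ratio u v ≡ nothing
  ratio-≡0 u {v} v≡0 with v ≟ 0#
  ... | yes _   = refl
  ... | no  v≢0 = ⊥-elim (v≢0 v≡0)

  ratio-≢0 : ∀ u {v} → v ≢ 0# → ratio u v ≡ just (u * v ⁻¹)
  ratio-≢0 u {v} v≢0 with v ≟ 0#
  ... | yes v≡0 = ⊥-elim (v≢0 v≡0)
  ... | no  _   = refl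

  ratio-* : ∀ {l} u v → l ≢ 0# → ratio (l * u) (l * v) ≡ ratio u v
  ratio-* {l} u v l≢0 with v ≟ 0#
  ... | yes v≡0 = ratio-≡0 (l * u) (trans (cong (l *_) v≡0) (zeroʳ l))
  ... | no  v≢0 = trans (ratio-≢0 (l * u) (*-≢0 l≢0 v≢0)) (cong just (/-unique (*-≢0 l≢0 v≢0) lu≡u/v*lv))
    where
    lu≡u/v*lv : l * u ≡ u * v ⁻¹ * (l * v)
    lu≡u/v*lv = begin
      l * u                ≡⟨ cong (l *_) (sym (/-*-cancel u v≢0)) ⟩
      l * (u * v ⁻¹ * v)   ≡⟨ solve 4 (λ l u w v → l :* (u :* w :* v) := u :* w :* (l :* v)) refl l u (v ⁻¹) v ⟩
      u * v ⁻¹ * (l * v)   ∎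
      where open ≡-Reasoning

  ratio-proportional : ∀ {u v u′ v′} → NotOrigin u v → NotOrigin u′ v′ → ratio u v ≡ ratio u′ v′ →
                       ∃ λ μ → μ ≢ 0# × u ≡ μ * u′ × v ≡ μ * v′
  ratio-proportional {u} {v} {u′} {v′} ¬o ¬o′ eq with v ≟ 0# | v′ ≟ 0#
  ... | yes v≡0 | yes v′≡0 = u * u′ ⁻¹ , *-≢0 u≢0 (⁻¹-≢0 u′≢0) , sym (/-*-cancel u u′≢0)
                            , trans v≡0 (sym (trans (cong (u * u′ ⁻¹ *_) v′≡0) (zeroʳ _)))
    where
    u≢0 : u ≢ 0#
    u≢0 u≡0 = ¬o (u≡0 , v≡0)
    u′≢0 : u′ ≢ 0#
    u′≢0 u′≡0 = ¬o′ (u′≡0 , v′≡0)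
  ... | yes _ | no _ with () ← eq
  ... | no _ | yes _ with () ← eq
  ... | no v≢0 | no v′≢0 = v * v′ ⁻¹ , *-≢0 v≢0 (⁻¹-≢0 v′≢0) , u≡v/v′*u′ , sym (/-*-cancel v v′≢0)
    where
    u≡v/v′*u′ : u ≡ v * v′ ⁻¹ * u′
    u≡v/v′*u′ = begin
      u                  ≡⟨ sym (/-*-cancel u v≢0) ⟩
      u * v ⁻¹ * v       ≡⟨ cong (_* v) (just-injective eq) ⟩
      u′ * v′ ⁻¹ * v     ≡⟨ solve 3 (λ a b c → a :* b :* c := c :* b :* a) refl u′ (v′ ⁻¹) v ⟩
      v * v′ ⁻¹ * u′     ∎
      where open ≡-Reasoning

  ratio-cross : ∀ {u v u′ v′} → u * v′ ≡ u′ * v → NotOrigin u v → NotOrigin u′ v′ → ratio u′ v′ ≡ ratio u v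
  ratio-cross {u} {v} {u′} {v′} uv′≡u′v ¬o ¬o′ with v ≟ 0# | v′ ≟ 0#
  ... | yes v≡0 | yes v′≡0 = refl
  ... | yes v≡0 | no v′≢0 =
    ⊥-elim (*-≢0 (λ u≡0 → ¬o (u≡0 , v≡0)) v′≢0 (trans uv′≡u′v (trans (cong (u′ *_) v≡0) (zeroʳ _))))
  ... | no v≢0 | yes v′≡0 =
    ⊥-elim (¬o′ (x*y≡0⇒y≡0 v≢0 (trans (*-comm _ _) (trans (sym uv′≡u′v) (trans (cong (u *_) v′≡0) (zeroʳ _)))) , v′≡0))
  ... | no v≢0 | no v′≢0 = cong just (/-unique v′≢0 (begin
      u′                    ≡⟨ sym (*-/-cancel u′ v≢0) ⟩
      u′ * v * v ⁻¹         ≡⟨ cong (_* v ⁻¹) (sym uv′≡u′v) ⟩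
      u * v′ * v ⁻¹         ≡⟨ solve 3 (λ a b c → a :* b :* c := a :* c :* b) refl u v′ (v ⁻¹) ⟩
      u * v ⁻¹ * v′         ∎))
    where open ≡-Reasoning

  ratio-surjective : ∀ z → ∃₂ λ u v → NotOrigin u v × ratio u v ≡ z
  ratio-surjective nothing  = 1# , 0# , (λ (1≡0 , _) → 1≢0 1≡0) , ratio-≡0 1# refl
  ratio-surjective (just t) = t , 1# , (λ (_ , 1≡0) → 1≢0 1≡0)
                            , trans (ratio-≢0 t 1≢0) (cong just (trans (cong (t *_) 1⁻¹≡1) (*-identityʳ t)))

  fixing-scalar≡1 : ∀ {k u v} → NotOrigin u v → k * u ≡ u → k * v ≡ v → k ≡ 1#
  fixing-scalar≡1 {k} {u} {v} ¬o ku≡u kv≡v with u ≟ 0# | v ≟ 0#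
  ... | no u≢0 | _       = *-cancelˡ u≢0 (trans (*-comm u k) (trans ku≡u (sym (*-identityʳ u))))
  ... | yes _  | no v≢0  = *-cancelˡ v≢0 (trans (*-comm v k) (trans kv≡v (sym (*-identityʳ v))))
  ... | yes u≡0 | yes v≡0 = ⊥-elim (¬o (u≡0 , v≡0))

  NoCommonRoot : Poly1 F → Poly1 F → Set
  NoCommonRoot P Q = ∀ t → NotOrigin (eval P t) (eval Q t)

  coprime⇒NoCommonRoot : ∀ P Q → Coprime1 F P Q → NoCommonRoot P Q
  coprime⇒NoCommonRoot P Q coprime t (P[t]≡0 , Q[t]≡0) =
    X-t-not-unit t (coprime (X- t) (root⇒X-t-divides P P[t]≡0) (root⇒X-t-divides Q Q[t]≡0))

  inducedMap-∞ : ∀ P Q → deg1 F P ℕ.< deg1 F Q → inducedMap F P Q nothing ≡ just 0#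
  inducedMap-∞ P Q deg-P<deg-Q with deg1 F Q ℕ.<ᵇ deg1 F P in Q<ᵇP
  ... | true  = ⊥-elim (ℕ.<-asym deg-P<deg-Q (ℕ.<ᵇ⇒< _ _ (subst T (sym Q<ᵇP) tt)))
  ... | false with deg1 F P ℕ.<ᵇ deg1 F Q in P<ᵇQ
  ...   | true  = refl
  ...   | false = ⊥-elim (subst T P<ᵇQ (ℕ.<⇒<ᵇ deg-P<deg-Q))

  deg1<deg1 : ∀ {n} P Q → DegreeAtMost n P → HasDegree (suc n) Q → deg1 F P ℕ.< deg1 F Q
  deg1<deg1 {n} P Q P≤n deg-Q = subst (deg1 F P ℕ.<_) (sym (deg1-HasDegree Q (suc n) deg-Q)) (s≤s (deg1-DegreeAtMost P n P≤n))

  cross-multiplied-deg< : ∀ P Q P′ Q′ {n} → DegreeAtMost n P → HasDegree (suc n) Q → NonZero1 F Q′ →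
                          P ⊠ Q′ ≋ P′ ⊠ Q → deg1 F P′ ℕ.⊔ deg1 F Q′ ≡ suc n → deg1 F P′ ℕ.< deg1 F Q′
  cross-multiplied-deg< P Q P′ Q′ {n} P≤n deg-Q Q′≢0 cross max≡1+n
    with IsZero⊎HasDegree P′ | IsZero⊎HasDegree Q′ | IsZero⊎HasDegree P
  ... | inj₁ P′≡0 | _ | _ = begin-strict
    deg1 F P′                  ≡⟨ deg1-IsZero P′ P′≡0 ⟩
    0                          <⟨ s≤s z≤n ⟩
    suc n                      ≡⟨ max≡1+n ⟨
    deg1 F P′ ℕ.⊔ deg1 F Q′    ≡⟨ cong (ℕ._⊔ deg1 F Q′) (deg1-IsZero P′ P′≡0) ⟩
    deg1 F Q′                  ∎
    where open ℕ.≤-Reasoning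
  ... | inj₂ _ | inj₁ Q′≡0 | _ = ⊥-elim (Q′≢0 Q′≡0)
  ... | inj₂ (k′ , deg-P′) | inj₂ _ | inj₁ P≡0 =
    ⊥-elim (proj₁ (HasDegree-⊠ P′ Q deg-P′ deg-Q) (trans (sym (cross _)) (IsZero-⊠ˡ P Q′ P≡0 _)))
  ... | inj₂ (k′ , deg-P′) | inj₂ (l′ , deg-Q′) | inj₂ (k , deg-P)
    rewrite deg1-HasDegree P′ k′ deg-P′ | deg1-HasDegree Q′ l′ deg-Q′ = ℕ.+-cancelʳ-≤ n (suc k′) l′ (begin
      suc k′ ℕ.+ n             ≡⟨ ℕ.+-suc k′ n ⟨
      k′ ℕ.+ suc n             ≡⟨ HasDegree-unique (P′ ⊠ Q) (⊠≋⇒HasDegree P Q′ (P′ ⊠ Q) deg-P deg-Q′ cross) (HasDegree-⊠ P′ Q deg-P′ deg-Q) ⟨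
      k ℕ.+ l′                 ≤⟨ ℕ.+-monoˡ-≤ l′ (HasDegree⇒≤ P deg-P P≤n) ⟩
      n ℕ.+ l′                 ≡⟨ ℕ.+-comm n l′ ⟩
      l′ ℕ.+ n                 ∎)
    where open ℕ.≤-Reasoning

  inducedMap-cross : ∀ P Q P′ Q′ → P ⊠ Q′ ≋ P′ ⊠ Q → NoCommonRoot P Q → NoCommonRoot P′ Q′ →
                     deg1 F P ℕ.< deg1 F Q → deg1 F P′ ℕ.< deg1 F Q′ → ∀ z → inducedMap F P′ Q′ z ≡ inducedMap F P Q z
  inducedMap-cross P Q P′ Q′ cross _ _ P<Q P′<Q′ nothing = trans (inducedMap-∞ P′ Q′ P′<Q′) (sym (inducedMap-∞ P Q P<Q))
  inducedMap-cross P Q P′ Q′ cross no-root no-root′ _ _ (just t) = ratio-cross eval-cross (no-root t) (no-root′ t)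
    where
    eval-cross : eval P t * eval Q′ t ≡ eval P′ t * eval Q t
    eval-cross = trans (sym (eval-⊠ P Q′ t)) (trans (eval-≋ (P ⊠ Q′) (P′ ⊠ Q) t cross) (eval-⊠ P′ Q t))

  PermutesP1-≗ : ∀ {h h′} → (∀ z → h z ≡ h′ z) → PermutesP1 F h → PermutesP1 F h′
  PermutesP1-≗ h≗h′ perm w with perm w
  ... | z , hz≡w , unique = z , trans (sym (h≗h′ z)) hz≡w , λ z′ h′z′≡w → unique z′ (trans (h≗h′ z′) h′z′≡w)

  -- Coprimality of P and Q makes P/Q its own lowest-terms representative.
  IsDegPermRatFun⇔ : ∀ {n} P Q → DegreeAtMost n P → HasDegree (suc n) Q → Coprime1 F P Q →
                     IsDegPermRatFun F P Q (suc n) ⇔ PermutesP1 F (inducedMap F P Q)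
  IsDegPermRatFun⇔ {n} P Q P≤n deg-Q coprime = mk⇔ to from
    where
    deg1-Q≡1+n : deg1 F Q ≡ suc n
    deg1-Q≡1+n = deg1-HasDegree Q (suc n) deg-Q
    deg-P<deg-Q : deg1 F P ℕ.< deg1 F Q
    deg-P<deg-Q = deg1<deg1 P Q P≤n deg-Q
    Q≢0 : NonZero1 F Q
    Q≢0 Q≡0 = proj₁ deg-Q (Q≡0 (suc n))
    to : IsDegPermRatFun F P Q (suc n) → PermutesP1 F (inducedMap F P Q)
    to (_ , P′ , Q′ , Q′≢0 , coprime′ , cross , max≡1+n , permutes′) = PermutesP1-≗
      (inducedMap-cross P Q P′ Q′ cross (coprime⇒NoCommonRoot P Q coprime) (coprime⇒NoCommonRoot P′ Q′ coprime′)
                        deg-P<deg-Q (cross-multiplied-deg< P Q P′ Q′ P≤n deg-Q Q′≢0 cross max≡1+n))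
      permutes′
    from : PermutesP1 F (inducedMap F P Q) → IsDegPermRatFun F P Q (suc n)
    from permutes = Q≢0 , P , Q , Q≢0 , coprime , (λ _ → refl)
                  , trans (ℕ.m≤n⇒m⊔n≡n (ℕ.<⇒≤ deg-P<deg-Q)) deg1-Q≡1+n , permutes

  -- Source lines are read in the coordinate y / x and target lines in u / v, matching φ = P / Q
  -- for forms f(x, y) = x ^ n P(y / x).
  module LiftedPermutation
    (φ : P1 F → P1 F) (G₁ G₂ : Carrier → Carrier → Carrier) (N : ℕ)
    (gcd[N,q-1]≡1 : gcd N (order ℕ.∸ 1) ≡ 1)
    (G₁-homogeneous : ∀ l x y → G₁ (l * x) (l * y) ≡ l ^ N * G₁ x y)
    (G₂-homogeneous : ∀ l x y → G₂ (l * x) (l * y) ≡ l ^ N * G₂ x y)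
    (G-origin : G₁ 0# 0# ≡ 0# × G₂ 0# 0# ≡ 0#)
    (G-NotOrigin : ∀ {x y} → NotOrigin x y → NotOrigin (G₁ x y) (G₂ x y))
    (φ-ratio : ∀ {x y} → NotOrigin x y → φ (ratio y x) ≡ ratio (G₁ x y) (G₂ x y))
    where
    open NthPowers N gcd[N,q-1]≡1

    G : Carrier × Carrier → Carrier × Carrier
    G (x , y) = G₁ x y , G₂ x y

    permutesPlane⇔ : PermutesPlane F G₁ G₂ ⇔ (∀ t → ExactlyOne (λ p → G p ≡ t))
    permutesPlane⇔ = mk⇔ to from
      where
      to : PermutesPlane F G₁ G₂ → ∀ t → ExactlyOne (λ p → G p ≡ t)
      to perm (u , v) with perm u v
      ... | p , Gp≡uv , unique = p , ×-≡,≡→≡ Gp≡uv , λ p′ Gp′≡uv → unique p′ (×-≡,≡←≡ Gp′≡uv)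
      from : (∀ t → ExactlyOne (λ p → G p ≡ t)) → PermutesPlane F G₁ G₂
      from perm u v with perm (u , v)
      ... | p , Gp≡uv , unique = p , ×-≡,≡←≡ Gp≡uv , λ p′ Gp′≡uv → unique p′ (×-≡,≡→≡ Gp′≡uv)

    G-zero⇒origin : ∀ {x y} → G (x , y) ≡ (0# , 0#) → (x , y) ≡ (0# , 0#)
    G-zero⇒origin {x} {y} Gp≡0 with origin? x y
    ... | inj₁ (refl , refl) = refl
    ... | inj₂ ¬o = ⊥-elim (G-NotOrigin ¬o (×-≡,≡←≡ Gp≡0))

    NotOrigin-preimage : ∀ {x y u v} → NotOrigin u v → G (x , y) ≡ (u , v) → NotOrigin x y
    NotOrigin-preimage ¬o Gp≡uv (refl , refl) = ¬o (×-≡,≡←≡ (trans (sym Gp≡uv) (×-≡,≡→≡ G-origin)))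

    -- Along the line through (x, y), G takes every value l ^ N * G (x, y), and l ^ N is any μ ≠ 0.
    onto-line⇒reached : ∀ {x y u v} → NotOrigin x y → NotOrigin u v →
                        ratio (G₁ x y) (G₂ x y) ≡ ratio u v → ∃ λ l → l ≢ 0# × G (l * x , l * y) ≡ (u , v)
    onto-line⇒reached {x} {y} ¬o ¬o-uv same-line with ratio-proportional ¬o-uv (G-NotOrigin ¬o) (sym same-line)
    ... | μ , μ≢0 , u≡μG₁ , v≡μG₂ with nthRoot μ≢0
    ... | l , l≢0 , l^N≡μ = l , l≢0 , ×-≡,≡→≡
      ( trans (G₁-homogeneous l x y) (trans (cong (_* G₁ x y) l^N≡μ) (sym u≡μG₁))
      , trans (G₂-homogeneous l x y) (trans (cong (_* G₂ x y) l^N≡μ) (sym v≡μG₂)) )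

    fixed-image⇒scalar≡1 : ∀ {κ x y} → κ ≢ 0# → NotOrigin x y → G (κ * x , κ * y) ≡ G (x , y) → κ ≡ 1#
    fixed-image⇒scalar≡1 {κ} {x} {y} κ≢0 ¬o Gκp≡Gp = ^N≡1⇒≡1 κ≢0 (fixing-scalar≡1 (G-NotOrigin ¬o)
      (trans (sym (G₁-homogeneous κ x y)) (,-injectiveˡ Gκp≡Gp))
      (trans (sym (G₂-homogeneous κ x y)) (,-injectiveʳ Gκp≡Gp)))

    same-line-and-image⇒≡ : ∀ {x y x′ y′} → NotOrigin x y → NotOrigin x′ y′ →
                            ratio y x ≡ ratio y′ x′ → G (x , y) ≡ G (x′ , y′) → (x , y) ≡ (x′ , y′)
    same-line-and-image⇒≡ {x} {y} {x′} {y′} ¬o ¬o′ same-line Gp≡Gp′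
      with ratio-proportional (¬o ∘ swap) (¬o′ ∘ swap) same-line
    ... | κ , κ≢0 , y≡κy′ , x≡κx′
      with fixed-image⇒scalar≡1 κ≢0 ¬o′ (trans (cong G (×-≡,≡→≡ (sym x≡κx′ , sym y≡κy′))) Gp≡Gp′)
    ... | refl = ×-≡,≡→≡ (trans x≡κx′ (*-identityˡ x′) , trans y≡κy′ (*-identityˡ y′))

    φ-injective⇒G-injective : Injective _≡_ _≡_ φ → Injective _≡_ _≡_ G
    φ-injective⇒G-injective φ-inj {x , y} {x′ , y′} Gp≡Gp′ with origin? x′ y′
    ... | inj₁ (refl , refl) = G-zero⇒origin (trans Gp≡Gp′ (×-≡,≡→≡ G-origin))
    ... | inj₂ ¬o′ = same-line-and-image⇒≡ ¬o ¬o′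
      (φ-inj (trans (φ-ratio ¬o) (trans (cong (uncurry ratio) Gp≡Gp′) (sym (φ-ratio ¬o′))))) Gp≡Gp′
      where
      ¬o : NotOrigin x y
      ¬o = NotOrigin-preimage (G-NotOrigin ¬o′) Gp≡Gp′

    φ-surjective⇒G-surjective : StrictlySurjective _≡_ φ → StrictlySurjective _≡_ G
    φ-surjective⇒G-surjective φ-surj (u , v) with origin? u v
    ... | inj₁ (refl , refl) = (0# , 0#) , ×-≡,≡→≡ G-origin
    ... | inj₂ ¬o with φ-surj (ratio u v)
    ...   | z , φz≡ratio with ratio-surjective z
    ...     | y , x , ¬o₀ , refl
      with onto-line⇒reached (¬o₀ ∘ swap) ¬o (trans (sym (φ-ratio (¬o₀ ∘ swap))) φz≡ratio)
    ...       | l , _ , Glp≡uv = (l * x , l * y) , Glp≡uv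

    G-injective⇒φ-injective : Injective _≡_ _≡_ G → Injective _≡_ _≡_ φ
    G-injective⇒φ-injective G-inj {z} {z′} φz≡φz′ with ratio-surjective z | ratio-surjective z′
    ... | y , x , ¬o , refl | y′ , x′ , ¬o′ , refl
      with onto-line⇒reached (¬o ∘ swap) (G-NotOrigin (¬o′ ∘ swap))
             (trans (sym (φ-ratio (¬o ∘ swap))) (trans φz≡φz′ (φ-ratio (¬o′ ∘ swap))))
    ...   | l , l≢0 , Glp≡Gp′ with G-inj Glp≡Gp′
    ...     | refl = sym (ratio-* y x l≢0)

    G-surjective⇒φ-surjective : StrictlySurjective _≡_ G → StrictlySurjective _≡_ φ
    G-surjective⇒φ-surjective G-surj w with ratio-surjective w
    ... | u , v , ¬o , refl with G-surj (u , v)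
    ...   | (x , y) , Gp≡uv = ratio y x , trans (φ-ratio (NotOrigin-preimage ¬o Gp≡uv)) (cong (uncurry ratio) Gp≡uv)

    permutesP1⇔permutesPlane : PermutesP1 F φ ⇔ PermutesPlane F G₁ G₂
    permutesP1⇔permutesPlane = mk⇔
      (λ perm → Equivalence.from permutesPlane⇔ (bijective⇒exactlyOne
        (φ-injective⇒G-injective (exactlyOne⇒injective perm))
        (φ-surjective⇒G-surjective (exactlyOne⇒surjective perm))))
      (λ perm → bijective⇒exactlyOne
        (G-injective⇒φ-injective (exactlyOne⇒injective (Equivalence.to permutesPlane⇔ perm)))
        (G-surjective⇒φ-surjective (exactlyOne⇒surjective (Equivalence.to permutesPlane⇔ perm))))

  extend0-last : ∀ {k} (a : Fin k → Carrier) → extend0 F a (Fin.fromℕ k) ≡ 0#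
  extend0-last {zero}  a = refl
  extend0-last {suc k} a = extend0-last (a ∘ Fin.suc)

  form-nonvanishing : ∀ m (c : Fin (suc m) → Carrier) → ¬ (∀ j → c j ≡ 0#) →
                      (1 ℕ.≤ m → ∀ x y → eval₂ (homForm F m c) x y ≡ 0# → x ≡ 0# × y ≡ 0#) →
                      ∀ {x y} → NotOrigin x y → eval₂ (homForm F m c) x y ≢ 0#
  form-nonvanishing zero    c c≢0 _     {x} {y} _  g≡0 = c≢0 (λ { Fin.zero → trans (sym (eval₂-homForm-constant c x y)) g≡0 })
  form-nonvanishing (suc m) c _   zeros {x} {y} ¬o g≡0 = ¬o (zeros (s≤s z≤n) x y g≡0)

  module Forms (n m : ℕ) (a : Fin (suc n) → Carrier) (b : Fin (suc (suc n)) → Carrier) (c : Fin (suc m) → Carrier) where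

    f₁ f₂ g : Poly2 F
    f₁ = homForm F (suc n) (extend0 F a)
    f₂ = homForm F (suc n) b
    g  = homForm F m c

    P Q : Poly1 F
    P = dehom f₁
    Q = dehom f₂

    G₁ G₂ : Carrier → Carrier → Carrier
    G₁ x y = eval₂ f₁ x y * eval₂ g x y
    G₂ x y = eval₂ f₂ x y * eval₂ g x y

    f₁-Homogeneous : Homogeneous (suc n) f₁
    f₁-Homogeneous = homForm-Homogeneous (suc n) (extend0 F a)

    f₂-Homogeneous : Homogeneous (suc n) f₂
    f₂-Homogeneous = homForm-Homogeneous (suc n) b

    g-Homogeneous : Homogeneous m g
    g-Homogeneous = homForm-Homogeneous m c

    P[1+n]≡0 : coeff P (suc n) ≡ 0#
    P[1+n]≡0 = trans (coeff-dehom-homForm-top (suc n) (extend0 F a)) (extend0-last a)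

    P-DegreeAtMost : DegreeAtMost n P
    P-DegreeAtMost k n<k with ℕ.m≤n⇒m<n∨m≡n n<k
    ... | inj₁ 1+n<k = Homogeneous⇒dehom-DegreeAtMost f₁ f₁-Homogeneous k 1+n<k
    ... | inj₂ refl  = P[1+n]≡0

    G₁-homogeneous : ∀ l x y → G₁ (l * x) (l * y) ≡ l ^ (m ℕ.+ suc n) * G₁ x y
    G₁-homogeneous l x y = eval₂-product-homogeneous f₁ g l x y f₁-Homogeneous g-Homogeneous

    G₂-homogeneous : ∀ l x y → G₂ (l * x) (l * y) ≡ l ^ (m ℕ.+ suc n) * G₂ x y
    G₂-homogeneous l x y = eval₂-product-homogeneous f₂ g l x y f₂-Homogeneous g-Homogeneous

    G-origin : G₁ 0# 0# ≡ 0# × G₂ 0# 0# ≡ 0#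
    G-origin = trans (cong (_* eval₂ g 0# 0#) (eval₂-homForm-origin n (extend0 F a))) (zeroˡ _)
             , trans (cong (_* eval₂ g 0# 0#) (eval₂-homForm-origin n b)) (zeroˡ _)

    G-dehom : ∀ f {x} y → Homogeneous (suc n) f → x ≢ 0# →
              eval₂ f x y * eval₂ g x y ≡ x ^ suc n * eval₂ g x y * eval (dehom f) (y * x ⁻¹)
    G-dehom f {x} y hom x≢0 = trans (cong (_* eval₂ g x y) (eval₂-dehom f y hom x≢0))
      (solve 3 (λ a b c → a :* b :* c := a :* c :* b) refl (x ^ suc n) (eval (dehom f) (y * x ⁻¹)) (eval₂ g x y))

    module _ (coprime : Coprime2 F f₁ f₂) where

      b-top≢0 : b (Fin.fromℕ (suc n)) ≢ 0#
      b-top≢0 b-top≡0 = X-not-unit (coprime X (X-divides f₁ f₁-Homogeneous P[1+n]≡0)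
        (X-divides f₂ f₂-Homogeneous (trans (coeff-dehom-homForm-top (suc n) b) b-top≡0)))

      Q-HasDegree : HasDegree (suc n) Q
      Q-HasDegree = (λ Q[1+n]≡0 → b-top≢0 (trans (sym (coeff-dehom-homForm-top (suc n) b)) Q[1+n]≡0))
                  , Homogeneous⇒dehom-DegreeAtMost f₂ f₂-Homogeneous

      P-Q-coprime : Coprime1 F P Q
      P-Q-coprime = coprime-forms⇒coprime-dehom f₁ f₂ f₁-Homogeneous f₂-Homogeneous Q-HasDegree coprime

      forms-NotOrigin : ∀ {x y} → NotOrigin x y → NotOrigin (eval₂ f₁ x y) (eval₂ f₂ x y)
      forms-NotOrigin {x} {y} ¬o (f₁≡0 , f₂≡0) with x ≟ 0#
      ... | yes refl = *-≢0 (^-≢0 (suc n) (λ y≡0 → ¬o (refl , y≡0))) b-top≢0 (trans (sym (eval₂-homForm-x≡0 (suc n) b y)) f₂≡0)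
      ... | no  x≢0  = coprime⇒NoCommonRoot P Q P-Q-coprime (y * x ⁻¹) (dehom-root f₁ f₁-Homogeneous f₁≡0 , dehom-root f₂ f₂-Homogeneous f₂≡0)
        where
        dehom-root : ∀ f → Homogeneous (suc n) f → eval₂ f x y ≡ 0# → eval (dehom f) (y * x ⁻¹) ≡ 0#
        dehom-root f hom f≡0 = x*y≡0⇒y≡0 (^-≢0 (suc n) x≢0) (trans (sym (eval₂-dehom f y hom x≢0)) f≡0)

      module _ (g≢0 : ∀ {x y} → NotOrigin x y → eval₂ g x y ≢ 0#) where

        G-NotOrigin : ∀ {x y} → NotOrigin x y → NotOrigin (G₁ x y) (G₂ x y)
        G-NotOrigin ¬o (G₁≡0 , G₂≡0) = forms-NotOrigin ¬o
          ( x*y≡0⇒y≡0 (g≢0 ¬o) (trans (*-comm _ _) G₁≡0)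
          , x*y≡0⇒y≡0 (g≢0 ¬o) (trans (*-comm _ _) G₂≡0) )

        φ-ratio : ∀ {x y} → NotOrigin x y → inducedMap F P Q (ratio y x) ≡ ratio (G₁ x y) (G₂ x y)
        φ-ratio {x} {y} ¬o with x ≟ 0#
        ... | yes refl = begin
          inducedMap F P Q nothing              ≡⟨ inducedMap-∞ P Q (deg1<deg1 P Q P-DegreeAtMost Q-HasDegree) ⟩
          just 0#                               ≡⟨ cong just (trans (cong (_* G₂ 0# y ⁻¹) G₁≡0) (zeroˡ _)) ⟨
          just (G₁ 0# y * G₂ 0# y ⁻¹)           ≡⟨ ratio-≢0 (G₁ 0# y) (λ G₂≡0 → G-NotOrigin ¬o (G₁≡0 , G₂≡0)) ⟨
          ratio (G₁ 0# y) (G₂ 0# y)             ∎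
          where
          open ≡-Reasoning
          G₁≡0 : G₁ 0# y ≡ 0#
          G₁≡0 = begin
            eval₂ f₁ 0# y * eval₂ g 0# y                              ≡⟨ cong (_* eval₂ g 0# y) (eval₂-homForm-x≡0 (suc n) (extend0 F a) y) ⟩
            y ^ suc n * extend0 F a (Fin.fromℕ (suc n)) * eval₂ g 0# y ≡⟨ cong (λ z → y ^ suc n * z * eval₂ g 0# y) (extend0-last a) ⟩
            y ^ suc n * 0# * eval₂ g 0# y                             ≡⟨ trans (cong (_* eval₂ g 0# y) (zeroʳ _)) (zeroˡ _) ⟩
            0#                                                        ∎
        ... | no x≢0 = begin
          inducedMap F P Q (just t)                     ≡⟨⟩
          ratio (eval P t) (eval Q t)                   ≡⟨ ratio-* (eval P t) (eval Q t) s≢0 ⟨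
          ratio (s * eval P t) (s * eval Q t)           ≡⟨ cong₂ ratio (G-dehom f₁ y f₁-Homogeneous x≢0) (G-dehom f₂ y f₂-Homogeneous x≢0) ⟨
          ratio (G₁ x y) (G₂ x y)                       ∎
          where
          open ≡-Reasoning
          t s : Carrier
          t = y * x ⁻¹
          s = x ^ suc n * eval₂ g x y
          s≢0 : s ≢ 0#
          s≢0 = *-≢0 (^-≢0 (suc n) x≢0) (g≢0 ¬o)

open import Data.Nat using (_≤_; _+_; _∸_)

proposition3p6 :
  (F : FiniteField) → (n m : ℕ) → 1 ≤ n →
  (a : Fin n → FiniteField.Carrier F) →
  (b : Fin (suc n) → FiniteField.Carrier F) →
  (c : Fin (suc m) → FiniteField.Carrier F) →
  Coprime2 F (homForm F n (extend0 F a)) (homForm F n b) →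
  ¬ (∀ j → c j ≡ FiniteField.0# F) →
  (1 ≤ m → ∀ x y → eval2 F (homForm F m c) x y ≡ FiniteField.0# F →
    x ≡ FiniteField.0# F × y ≡ FiniteField.0# F) →
  gcd (m + n) (FiniteField.order F ∸ 1) ≡ 1 →
  (IsDegPermRatFun F (atX1 F (homForm F n (extend0 F a))) (atX1 F (homForm F n b)) n
    ⇔ PermutesPlane F
        (λ x y → FiniteField._*_ F (eval2 F (homForm F n (extend0 F a)) x y)
                                    (eval2 F (homForm F m c) x y))
        (λ x y → FiniteField._*_ F (eval2 F (homForm F n b) x y)
                                    (eval2 F (homForm F m c) x y)))
proposition3p6 F zero    m () a b c coprime c≢0 g-zeros gcd≡1
proposition3p6 F (suc n) m _  a b c coprime c≢0 g-zeros gcd≡1 =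
  ⇔-trans (IsDegPermRatFun⇔ F P Q P-DegreeAtMost (Q-HasDegree coprime) (P-Q-coprime coprime))
          (LiftedPermutation.permutesP1⇔permutesPlane F (inducedMap F P Q) G₁ G₂ (m + suc n) gcd≡1
             G₁-homogeneous G₂-homogeneous G-origin (G-NotOrigin coprime g≢0) (φ-ratio coprime g≢0))
  where
  open Forms F n m a b c
  g≢0 : ∀ {x y} → NotOrigin F x y → eval₂ F g x y ≢ FiniteField.0# F
  g≢0 = form-nonvanishing F m c c≢0 g-zeros
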